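{- For $h\ge 1$ let $[h]_{p,q,x}=\sum_{j=0}^{h-2}p^{h-1-j}q^{j}+x\,q^{h-1}$ (so $[1]_{p,q,x}=x$). Then, as formal power series in $z$, \[ F_{\text{1--2, 2--1}}(p,q,x,z):=\sum_{n\ge1}\sum_{\pi\in\mathcal S_n}p^{\mathrm{non}(\pi)}q^{\mathrm{inv}(\pi)}x^{\mathrm{cyc}(\pi)}z^{n} =\sum_{n=1}^{\infty}z^{n}\prod_{i=1}^{n}[i]_{p,q,x} =\cfrac{a_1z}{1-\cfrac{a_2z}{1+a_2z-\cfrac{a_3z}{1+a_3z-\cfrac{a_4z}{1+a_4z-\cdots}}}}, \] where $a_h=[h]_{p,q,x}$.
   Context: $\mathcal S_n$ is the set of permutations of $[n]=\{1,\dots,n\}$. The standard cycle form of $\pi\in\mathcal S_n$ writes each cycle starting with its smallest element and lists the cycles in decreasing order of their smallest elements (e.g. $47613852=(275368)(14)$). $\Psi(\pi)$ is the word of length $n$ obtained by deleting the parentheses from the standard cycle form. $\mathrm{cyc}(\pi)$ is the number of cycles of $\pi$. $\mathrm{inv}(\pi)$ (cyclic inversions) is the number of pairs of positions $i<j$ with $\Psi(\pi)_i>\Psi(\pi)_j$, and $\mathrm{non}(\pi)=\binom{n}{2}-\mathrm{inv}(\pi)$. -}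

module Defs where

open import Data.Nat as ℕ using (ℕ; zero; suc; _∸_; _<ᵇ_; _≤ᵇ_; _≡ᵇ_)
open import Data.Nat.Combinatorics using (_C_)
open import Data.Fin using (Fin; toℕ)
open import Data.Bool using (Bool; true; false; if_then_else_; _∧_; _∨_; not)
open import Data.List using (List; []; _∷_; length; concatMap; map; allFin; reverse; foldr)
open import Data.Vec as Vec using (Vec; lookup)
open import Algebra.Bundles using (CommutativeRing)

-- Finite combinatorics of permutations.
-- Elements of [n] are represented by Fin n (0-based: i ↦ i+1); this is an
-- order-preserving relabelling, so cycle forms / inversions are unchanged.

allᵇ : {A : Set} → (A → Bool) → List A → Bool
allᵇ P [] = true
allᵇ P (a ∷ as) = P a ∧ allᵇ P as

filterᵇ : {A : Set} → (A → Bool) → List A → List A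
filterᵇ P [] = []
filterᵇ P (a ∷ as) = if P a then a ∷ filterᵇ P as else filterᵇ P as

allVecs : {A : Set} → List A → (m : ℕ) → List (Vec A m)
allVecs xs zero = Vec.[] ∷ []
allVecs xs (suc m) = concatMap (λ a → map (a Vec.∷_) (allVecs xs m)) xs

injectiveᵇ : {n m : ℕ} → Vec (Fin n) m → Bool
injectiveᵇ {m = m} v =
  allᵇ (λ i → allᵇ (λ j → (toℕ i ≡ᵇ toℕ j) ∨ not (toℕ (lookup v i) ≡ᵇ toℕ (lookup v j)))
                 (allFin m))
      (allFin m)

-- S_n, each permutation π given in one-line notation (π(i) = lookup v i)
Sn : (n : ℕ) → List (Vec (Fin n) n)
Sn n = filterᵇ injectiveᵇ (allVecs (allFin n) n)

module CycleForm {n : ℕ} (π : Fin n → Fin n) where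

  orbit : ℕ → Fin n → Fin n → List (Fin n)
  orbit zero s c = []
  orbit (suc f) s c = if toℕ c ≡ᵇ toℕ s then [] else c ∷ orbit f s (π c)

  cycleOf : Fin n → List (Fin n)
  cycleOf i = i ∷ orbit n i (π i)

  isCycleMin : Fin n → Bool
  isCycleMin i = allᵇ (λ j → toℕ i ≤ᵇ toℕ j) (cycleOf i)

  -- Ψ(π): standard cycle form (cycles starting at their minima, listed in
  -- decreasing order of minima) with parentheses erased
  Ψ : List (Fin n)
  Ψ = concatMap cycleOf (filterᵇ isCycleMin (reverse (allFin n)))

  cyc : ℕ
  cyc = length (filterᵇ isCycleMin (allFin n))

  invWord : List (Fin n) → ℕ
  invWord [] = 0
  invWord (a ∷ w) = length (filterᵇ (λ b → toℕ b <ᵇ toℕ a) w) ℕ.+ invWord w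

  cinv : ℕ
  cinv = invWord Ψ

  non : ℕ
  non = (n C 2) ∸ cinv

module Series {c ℓ} (R : CommutativeRing c ℓ) where
  open CommutativeRing R

  Ser : Set c
  Ser = ℕ → Carrier

  pow : Carrier → ℕ → Carrier
  pow a zero = 1#
  pow a (suc k) = a * pow a k

  sumTo : ℕ → (ℕ → Carrier) → Carrier
  sumTo zero f = 0#
  sumTo (suc m) f = sumTo m f + f m

  prod1To : ℕ → (ℕ → Carrier) → Carrier
  prod1To zero f = 1#
  prod1To (suc m) f = prod1To m f * f (suc m)

  sumList : List Carrier → Carrier
  sumList = foldr _+_ 0#

  zeroS : Ser
  zeroS _ = 0#

  oneS : Ser
  oneS zero = 1#
  oneS (suc _) = 0#

  _⊕_ : Ser → Ser → Ser
  (f ⊕ g) k = f k + g k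

  _⊖_ : Ser → Ser → Ser
  (f ⊖ g) k = f k - g k

  _⊛_ : Ser → Ser → Ser
  (f ⊛ g) k = sumTo (suc k) (λ i → f i * g (k ∸ i))

  powS : Ser → ℕ → Ser
  powS g zero = oneS
  powS g (suc k) = g ⊛ powS g k

  -- 1/(1 - g) for g with zero constant term: Σ_k g^k (coefficient k only
  -- receives contributions from g^0,…,g^k)
  recip1- : Ser → Ser
  recip1- g k = sumTo (suc k) (λ j → powS g j k)

  monoZ : Carrier → Ser
  monoZ a zero = 0#
  monoZ a (suc zero) = a
  monoZ a (suc (suc _)) = 0#

module PQX {c ℓ} (R : CommutativeRing c ℓ) (p q x : CommutativeRing.Carrier R) where
  open CommutativeRing R
  open Series R public

  -- [h]_{p,q,x} for h ≥ 1 (argument suc h' means h = h'+1):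
  -- Σ_{j=0}^{h-2} p^{h-1-j} q^j + x q^{h-1}
  bracket : ℕ → Carrier
  bracket zero = 0#   -- never used (h ≥ 1)
  bracket (suc h') = sumTo h' (λ j → pow p (h' ∸ j) * pow q j) + x * pow q h'

  weight : {n : ℕ} → Vec (Fin n) n → Carrier
  weight v = pow p non * pow q cinv * pow x cyc
    where open CycleForm (lookup v)

  -- [z^n] F_{1-2,2-1}(p,q,x,z)   (sum starts at n = 1)
  F : Ser
  F zero = 0#
  F (suc m) = sumList (map weight (Sn (suc m)))

  -- [z^n] Σ_{n≥1} z^n Π_{i=1}^n [i]
  G : Ser
  G zero = 0#
  G (suc m) = prod1To (suc m) bracket

  -- Truncated continued fraction.  E d h is the tail
  --   a_h z / (1 + a_h z - a_{h+1} z / (1 + a_{h+1} z - …))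
  -- cut off after d levels (innermost tail replaced by 0).
  E : ℕ → ℕ → Ser
  E zero h = zeroS
  E (suc d) h = monoZ (bracket h) ⊛ recip1- (E d (suc h) ⊖ monoZ (bracket h))

  CF : ℕ → Ser
  CF N = monoZ (bracket 1) ⊛ recip1- (E N 2)

-- Writing the new letter n+1 into the cycle form of σ ∈ S_n, either as a fixed point or
-- directly after one of the letters c, is a bijection [n+1] × S_n ≅ S_{n+1}. A fixed point
-- is a cycle with the largest minimum, so it goes to the front of Ψ: one more cycle and
-- n more cyclic inversions, a factor x q^n. Inserted after c, the new letter stays inside
-- c's cycle and lands right after c in Ψ, where it is inverted with the k letters following c
-- and with no other letter: a factor p^(n-k) q^k. As c runs over [n], k runs over 0, …, n-1,
-- so the weights of S_{n+1} sum to [n+1] times those of S_n, and F = Σ_n z^n Π_{i ≤ n} [i].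
--
-- For the continued fraction put U_h = Σ_k a_h a_(h+1) ⋯ a_(h+k-1) z^k, so U_h = 1 + a_h z U_(h+1).
-- Then T_h = 1 - 1/U_h satisfies T_h = a_h z / (1 + a_h z - T_(h+1)), and by induction on the
-- depth the truncated tail at level h agrees with T_h up to z^depth; at the top,
-- a_1 z / (1 - T_2) = a_1 z U_2 = Σ_n z^n a_1 ⋯ a_n.

module Submission where

open import Defs
open import Data.Nat as ℕ using (ℕ; zero; suc; _≤_; _<_; z≤n; s≤s; _≤′_; ≤′-refl; ≤′-step; _≡ᵇ_; _<ᵇ_; _≤ᵇ_)
import Data.Nat.Properties as ℕ
open import Data.Nat.Combinatorics using (_C_; nC1≡n; nCk+nC[k+1]≡[n+1]C[k+1])
open import Data.Bool using (Bool; true; false; if_then_else_; _∧_; _∨_; not; T)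
open import Data.Bool.Properties using (∨-zeroʳ; ∨-identityʳ)
open import Data.Fin as Fin using (Fin; toℕ; fromℕ; inject₁)
import Data.Fin.Properties as Fin
open import Data.Fin.Relation.Unary.Top using (view; ‵fromℕ; ‵inject₁)
open import Data.List as List using (List; []; _∷_; _++_; [_]; _∷ʳ_; length; map; concatMap; allFin; reverse; downFrom)
import Data.List.Properties as List
open import Data.List.Membership.Propositional using (_∈_; _∉_; find; lose)
open import Data.List.Membership.Propositional.Properties using (∈-map⁺; ∈-map⁻; ∈-++⁺ʳ; ∈-∃++; ∈-allFin; ∈-concatMap⁺; ∈-concatMap⁻)
open import Data.List.Relation.Unary.Any using (here; there)
open import Data.List.Relation.Unary.All as All using ([]; _∷_)
open import Data.List.Relation.Unary.All.Properties using (¬Any⇒All¬)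
open import Data.List.Relation.Unary.Unique.Propositional using (Unique; []; _∷_)
import Data.List.Relation.Unary.Unique.Propositional.Properties as Unique
open import Data.List.Relation.Unary.Unique.Propositional.Properties using (Unique[x∷xs]⇒x∉xs)
open import Data.List.Relation.Binary.Permutation.Propositional as ↭ using (_↭_; ↭⇒↭ₛ′)
import Data.List.Relation.Binary.Permutation.Propositional.Properties as ↭
import Data.List.Relation.Binary.Permutation.Setoid.Properties as ↭ₛ
open import Data.Vec as Vec using (Vec; lookup)
import Data.Vec.Properties as Vec
open import Data.Product using (Σ; ∃; _×_; _,_; proj₁; proj₂)
open import Data.Sum using (_⊎_; inj₁; inj₂)
open import Data.Empty using (⊥-elim)
open import Data.Unit using (tt)
open import Relation.Nullary using (yes; no)
import Relation.Binary.PropositionalEquality as ≡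
open ≡ using (_≡_; _≗_)
open import Function using (_∘_; id)
open import Function.Definitions using (Injective)
open import Algebra.Bundles using (CommutativeRing)

open CycleForm using (orbit; cycleOf; isCycleMin; Ψ; cyc; invWord; cinv; non)

module Permutations where
  open ≡ hiding ([_])
  open import Data.Nat.Base using (_+_; _∸_)

  ≡ᵇ⇒≡ : ∀ {m n} → (m ≡ᵇ n) ≡ true → m ≡ n
  ≡ᵇ⇒≡ {m} {n} e = ℕ.≡ᵇ⇒≡ m n (subst T (sym e) tt)

  ≢⇒≡ᵇ-false : ∀ {m n} → m ≢ n → (m ≡ᵇ n) ≡ false
  ≢⇒≡ᵇ-false {m} {n} m≢n with m ≡ᵇ n in e
  ... | true = ⊥-elim (m≢n (≡ᵇ⇒≡ e))
  ... | false = refl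

  T⇒≡true : ∀ {b} → T b → b ≡ true
  T⇒≡true {true} _ = refl

  ≡ᵇ-refl : ∀ n → (n ≡ᵇ n) ≡ true
  ≡ᵇ-refl n = T⇒≡true (ℕ.≡⇒≡ᵇ n n refl)

  ≤⇒≤ᵇ-true : ∀ {m n} → m ≤ n → (m ≤ᵇ n) ≡ true
  ≤⇒≤ᵇ-true m≤n = T⇒≡true (ℕ.≤⇒≤ᵇ m≤n)

  ≤ᵇ-true⇒≤ : ∀ {m n} → (m ≤ᵇ n) ≡ true → m ≤ n
  ≤ᵇ-true⇒≤ {m} {n} e = ℕ.≤ᵇ⇒≤ m n (subst T (sym e) tt)

  <⇒<ᵇ-true : ∀ {m n} → m < n → (m <ᵇ n) ≡ true
  <⇒<ᵇ-true m<n = T⇒≡true (ℕ.<⇒<ᵇ m<n)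

  ≤⇒>ᵇ-false : ∀ {m n} → m ≤ n → (n <ᵇ m) ≡ false
  ≤⇒>ᵇ-false {m} {n} m≤n with n <ᵇ m in e
  ... | false = refl
  ... | true = ⊥-elim (ℕ.<⇒≱ (ℕ.<ᵇ⇒< n m (subst T (sym e) tt)) m≤n)

  if-true : ∀ {A : Set} {b : Bool} {x y : A} → b ≡ true → (if b then x else y) ≡ x
  if-true refl = refl

  if-false : ∀ {A : Set} {b : Bool} {x y : A} → b ≡ false → (if b then x else y) ≡ y
  if-false refl = refl

  -- Unfolds to the test toℕ a ≡ᵇ toℕ b that Defs uses on Fin.
  _=ᶠ_ : ∀ {n} → Fin n → Fin n → Bool
  a =ᶠ b = toℕ a ≡ᵇ toℕ b

  =ᶠ⇒≡ : ∀ {n} {a b : Fin n} → (a =ᶠ b) ≡ true → a ≡ b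
  =ᶠ⇒≡ e = Fin.toℕ-injective (≡ᵇ⇒≡ e)

  =ᶠ-refl : ∀ {n} (a : Fin n) → (a =ᶠ a) ≡ true
  =ᶠ-refl a = ≡ᵇ-refl (toℕ a)

  ≢⇒=ᶠ-false : ∀ {n} {a b : Fin n} → a ≢ b → (a =ᶠ b) ≡ false
  ≢⇒=ᶠ-false a≢b = ≢⇒≡ᵇ-false (a≢b ∘ Fin.toℕ-injective)

  =ᶠ-false⇒≢ : ∀ {n} {a b : Fin n} → (a =ᶠ b) ≡ false → a ≢ b
  =ᶠ-false⇒≢ {a = a} e refl with () ← trans (sym (=ᶠ-refl a)) e

  -- Case analysis on Fin (suc n) = inject₁ (Fin n) ∪ {fromℕ n}, as a computing eliminator.
  caseLast : ∀ {n} {P : Set} → (Fin n → P) → P → Fin (suc n) → P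
  caseLast {zero} f t _ = t
  caseLast {suc n} f t Fin.zero = f Fin.zero
  caseLast {suc n} f t (Fin.suc k) = caseLast (f ∘ Fin.suc) t k

  caseLast-inject₁ : ∀ {n} {P : Set} (f : Fin n → P) t i → caseLast f t (inject₁ i) ≡ f i
  caseLast-inject₁ {suc n} f t Fin.zero = refl
  caseLast-inject₁ {suc n} f t (Fin.suc i) = caseLast-inject₁ (f ∘ Fin.suc) t i

  caseLast-fromℕ : ∀ n {P : Set} (f : Fin n → P) t → caseLast f t (fromℕ n) ≡ t
  caseLast-fromℕ zero f t = refl
  caseLast-fromℕ (suc n) f t = caseLast-fromℕ n (f ∘ Fin.suc) t

  caseLast-cong : ∀ {n} {P : Set} {f g : Fin n → P} {t t′ : P} → f ≗ g → t ≡ t′ → caseLast f t ≗ caseLast g t′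
  caseLast-cong {zero} f≗g t≡t′ k = t≡t′
  caseLast-cong {suc n} f≗g t≡t′ Fin.zero = f≗g Fin.zero
  caseLast-cong {suc n} f≗g t≡t′ (Fin.suc k) = caseLast-cong (f≗g ∘ Fin.suc) t≡t′ k

  inject₁≢fromℕ : ∀ {n} (i : Fin n) → inject₁ i ≢ fromℕ n
  inject₁≢fromℕ i = Fin.fromℕ≢inject₁ ∘ sym

  fromℕ∉map-inject₁ : ∀ {n} (w : List (Fin n)) → fromℕ n ∉ map inject₁ w
  fromℕ∉map-inject₁ w m = let (i , _ , e) = ∈-map⁻ inject₁ m in inject₁≢fromℕ i (sym e)

  allFin-suc : ∀ n → allFin (suc n) ≡ map inject₁ (allFin n) ∷ʳ fromℕ n
  allFin-suc n = trans (tabulate-snoc n id) (cong (_∷ʳ fromℕ n) (sym (List.map-tabulate id inject₁)))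
    where
    tabulate-snoc : ∀ {A : Set} n (f : Fin (suc n) → A) → List.tabulate f ≡ List.tabulate (f ∘ inject₁) ∷ʳ f (fromℕ n)
    tabulate-snoc zero f = refl
    tabulate-snoc (suc n) f = cong (f Fin.zero ∷_) (tabulate-snoc n (f ∘ Fin.suc))

  reverse-allFin-suc : ∀ n → reverse (allFin (suc n)) ≡ fromℕ n ∷ map inject₁ (reverse (allFin n))
  reverse-allFin-suc n = begin
    reverse (allFin (suc n))                     ≡⟨ cong reverse (allFin-suc n) ⟩
    reverse (map inject₁ (allFin n) ++ [ fromℕ n ]) ≡⟨ List.reverse-++ (map inject₁ (allFin n)) [ fromℕ n ] ⟩
    fromℕ n ∷ reverse (map inject₁ (allFin n))   ≡⟨ cong (fromℕ n ∷_) (List.reverse-map inject₁ (allFin n)) ⟨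
    fromℕ n ∷ map inject₁ (reverse (allFin n))   ∎
    where open ≡-Reasoning

  module _ {A : Set} where

    ∷-Unique : ∀ {x : A} {xs} → x ∉ xs → Unique xs → Unique (x ∷ xs)
    ∷-Unique x∉xs u = ¬Any⇒All¬ _ x∉xs ∷ u

    Unique-∷⁻ : ∀ {x : A} {xs} → Unique (x ∷ xs) → Unique xs
    Unique-∷⁻ (_ ∷ u) = u

    Unique-resp-↭ : ∀ {xs ys : List A} → xs ↭ ys → Unique xs → Unique ys
    Unique-resp-↭ p = ↭ₛ.Unique-resp-↭ (setoid A) (↭⇒↭ₛ′ isEquivalence p)

    Unique-∷ʳ : ∀ {a : A} {w} → Unique (a ∷ w) → Unique (w ∷ʳ a)
    Unique-∷ʳ {a} {w} u@(_ ∷ uw) = Unique.++⁺ uw ([] ∷ []) λ { (a∈w , here refl) → Unique[x∷xs]⇒x∉xs u a∈w }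

    Unique-⊆-⊇⇒↭ : ∀ {xs ys : List A} → Unique xs → Unique ys →
                   (∀ {z} → z ∈ xs → z ∈ ys) → (∀ {z} → z ∈ ys → z ∈ xs) → xs ↭ ys
    Unique-⊆-⊇⇒↭ {[]} {[]} _ _ _ _ = ↭.refl
    Unique-⊆-⊇⇒↭ {[]} {y ∷ ys} _ _ _ ys⊆xs with () ← ys⊆xs (here refl)
    Unique-⊆-⊇⇒↭ {x ∷ xs} {ys} ux uy xs⊆ys ys⊆xs with ∈-∃++ (xs⊆ys (here refl))
    ... | ys₁ , ys₂ , refl = ↭.↭-sym (↭.trans shift (↭.prep x (↭.↭-sym rest)))
      where
      shift : ys₁ ++ [ x ] ++ ys₂ ↭ x ∷ ys₁ ++ ys₂
      shift = ↭.shift x ys₁ ys₂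
      uy′ : Unique (x ∷ ys₁ ++ ys₂)
      uy′ = Unique-resp-↭ shift uy
      rest : xs ↭ ys₁ ++ ys₂
      rest = Unique-⊆-⊇⇒↭ (Unique-∷⁻ ux) (Unique-∷⁻ uy′) ⊆ ⊇
        where
        ⊆ : ∀ {z} → z ∈ xs → z ∈ ys₁ ++ ys₂
        ⊆ z∈xs with ↭.∈-resp-↭ shift (xs⊆ys (there z∈xs))
        ... | here refl = ⊥-elim (Unique[x∷xs]⇒x∉xs ux z∈xs)
        ... | there z∈ = z∈
        ⊇ : ∀ {z} → z ∈ ys₁ ++ ys₂ → z ∈ xs
        ⊇ z∈ with ys⊆xs (↭.∈-resp-↭ (↭.↭-sym shift) (there z∈))
        ... | here refl = ⊥-elim (Unique[x∷xs]⇒x∉xs uy′ z∈)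
        ... | there z∈xs = z∈xs

    Unique-concatMap : ∀ {B : Set} (f : A → List B) (tag : B → A) {xs} → Unique xs → (∀ x → Unique (f x)) →
                       (∀ {x y} → y ∈ f x → tag y ≡ x) → Unique (concatMap f xs)
    Unique-concatMap f tag [] uf tagged = []
    Unique-concatMap f tag {x ∷ xs} u@(_ ∷ uxs) uf tagged =
      Unique.++⁺ (uf x) (Unique-concatMap f tag uxs uf tagged) λ (y∈fx , y∈rest) →
        let (x′ , x′∈xs , y∈fx′) = find (∈-concatMap⁻ f {xs = xs} y∈rest)
        in Unique[x∷xs]⇒x∉xs u (subst (_∈ xs) (trans (sym (tagged y∈fx′)) (tagged y∈fx)) x′∈xs)

  module _ {A : Set} (P : A → Bool) where

    ∈-filterᵇ⁺ : ∀ {x xs} → x ∈ xs → P x ≡ true → x ∈ filterᵇ P xs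
    ∈-filterᵇ⁺ {xs = y ∷ xs} (here refl) Px rewrite Px = here refl
    ∈-filterᵇ⁺ {xs = y ∷ xs} (there x∈xs) Px with P y
    ... | true = there (∈-filterᵇ⁺ x∈xs Px)
    ... | false = ∈-filterᵇ⁺ x∈xs Px

    ∈-filterᵇ⁻ : ∀ {x xs} → x ∈ filterᵇ P xs → x ∈ xs × P x ≡ true
    ∈-filterᵇ⁻ {xs = y ∷ xs} x∈ with P y in Py
    ∈-filterᵇ⁻ {xs = y ∷ xs} (here refl) | true = here refl , Py
    ∈-filterᵇ⁻ {xs = y ∷ xs} (there x∈) | true = let (x∈xs , Px) = ∈-filterᵇ⁻ x∈ in there x∈xs , Px
    ∈-filterᵇ⁻ {xs = y ∷ xs} x∈ | false = let (x∈xs , Px) = ∈-filterᵇ⁻ x∈ in there x∈xs , Px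

    Unique-filterᵇ : ∀ {xs} → Unique xs → Unique (filterᵇ P xs)
    Unique-filterᵇ [] = []
    Unique-filterᵇ {x ∷ xs} u@(_ ∷ uxs) with P x
    ... | true = ∷-Unique (Unique[x∷xs]⇒x∉xs u ∘ proj₁ ∘ ∈-filterᵇ⁻) (Unique-filterᵇ uxs)
    ... | false = Unique-filterᵇ uxs

    filterᵇ-++ : ∀ xs ys → filterᵇ P (xs ++ ys) ≡ filterᵇ P xs ++ filterᵇ P ys
    filterᵇ-++ [] ys = refl
    filterᵇ-++ (x ∷ xs) ys with P x
    ... | true = cong (x ∷_) (filterᵇ-++ xs ys)
    ... | false = filterᵇ-++ xs ys

    filterᵇ-∷-true : ∀ {a} w → P a ≡ true → filterᵇ P (a ∷ w) ≡ a ∷ filterᵇ P w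
    filterᵇ-∷-true w Pa rewrite Pa = refl

    filterᵇ-∷-false : ∀ {a} w → P a ≡ false → filterᵇ P (a ∷ w) ≡ filterᵇ P w
    filterᵇ-∷-false w Pa rewrite Pa = refl

    filterᵇ-all : ∀ w → (∀ {x} → x ∈ w → P x ≡ true) → filterᵇ P w ≡ w
    filterᵇ-all [] h = refl
    filterᵇ-all (x ∷ w) h rewrite h (here refl) = cong (x ∷_) (filterᵇ-all w (h ∘ there))

    length-filterᵇ≤ : ∀ w → length (filterᵇ P w) ≤ length w
    length-filterᵇ≤ [] = z≤n
    length-filterᵇ≤ (x ∷ w) with P x
    ... | true = s≤s (length-filterᵇ≤ w)
    ... | false = ℕ.m≤n⇒m≤1+n (length-filterᵇ≤ w)

    allᵇ-sound : ∀ {x xs} → allᵇ P xs ≡ true → x ∈ xs → P x ≡ true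
    allᵇ-sound {xs = y ∷ xs} e x∈ with P y in Py
    allᵇ-sound {xs = y ∷ xs} e (here refl) | true = Py
    allᵇ-sound {xs = y ∷ xs} e (there x∈) | true = allᵇ-sound e x∈

    allᵇ-complete : ∀ xs → (∀ {x} → x ∈ xs → P x ≡ true) → allᵇ P xs ≡ true
    allᵇ-complete [] h = refl
    allᵇ-complete (x ∷ xs) h rewrite h (here refl) = allᵇ-complete xs (h ∘ there)

    allᵇ-map : ∀ {B : Set} (f : B → A) xs → allᵇ P (map f xs) ≡ allᵇ (P ∘ f) xs
    allᵇ-map f [] = refl
    allᵇ-map f (x ∷ xs) = cong (P (f x) ∧_) (allᵇ-map f xs)

  module _ {A : Set} {P Q : A → Bool} where

    filterᵇ-cong : ∀ xs → (∀ {x} → x ∈ xs → P x ≡ Q x) → filterᵇ P xs ≡ filterᵇ Q xs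
    filterᵇ-cong [] e = refl
    filterᵇ-cong (x ∷ xs) e rewrite e (here refl) with Q x
    ... | true = cong (x ∷_) (filterᵇ-cong xs (e ∘ there))
    ... | false = filterᵇ-cong xs (e ∘ there)

    allᵇ-cong : ∀ xs → (∀ {x} → x ∈ xs → P x ≡ Q x) → allᵇ P xs ≡ allᵇ Q xs
    allᵇ-cong [] e = refl
    allᵇ-cong (x ∷ xs) e = cong₂ _∧_ (e (here refl)) (allᵇ-cong xs (e ∘ there))

  filterᵇ-map : ∀ {A B : Set} (P : B → Bool) (f : A → B) xs → filterᵇ P (map f xs) ≡ map f (filterᵇ (P ∘ f) xs)
  filterᵇ-map P f [] = refl
  filterᵇ-map P f (x ∷ xs) with P (f x)
  ... | true = cong (f x ∷_) (filterᵇ-map P f xs)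
  ... | false = filterᵇ-map P f xs

  insertAfter : ∀ {A : Set} → (A → Bool) → A → List A → List A
  insertAfter e t [] = []
  insertAfter e t (a ∷ w) = if e a then a ∷ t ∷ insertAfter e t w else a ∷ insertAfter e t w

  AtMostOne : ∀ {A : Set} → (A → Bool) → Set
  AtMostOne e = ∀ {a b} → e a ≡ true → e b ≡ true → a ≡ b

  module _ {A : Set} (e : A → Bool) (t : A) where

    insertAfter-∷-true : ∀ {a} w → e a ≡ true → insertAfter e t (a ∷ w) ≡ a ∷ t ∷ insertAfter e t w
    insertAfter-∷-true w ea rewrite ea = refl

    insertAfter-∷-false : ∀ {a} w → e a ≡ false → insertAfter e t (a ∷ w) ≡ a ∷ insertAfter e t w
    insertAfter-∷-false w ea rewrite ea = refl

    insertAfter-id : ∀ w → (∀ {a} → a ∈ w → e a ≡ false) → insertAfter e t w ≡ w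
    insertAfter-id [] h = refl
    insertAfter-id (a ∷ w) h rewrite h (here refl) = cong (a ∷_) (insertAfter-id w (h ∘ there))

    insertAfter-++ : ∀ u w → insertAfter e t (u ++ w) ≡ insertAfter e t u ++ insertAfter e t w
    insertAfter-++ [] w = refl
    insertAfter-++ (a ∷ u) w with e a
    ... | true = cong (λ z → a ∷ t ∷ z) (insertAfter-++ u w)
    ... | false = cong (a ∷_) (insertAfter-++ u w)

    ∈-insertAfter⁺ : ∀ {y} w → y ∈ w → y ∈ insertAfter e t w
    ∈-insertAfter⁺ (a ∷ w) y∈ with e a | y∈
    ... | true | here refl = here refl
    ... | true | there y∈w = there (there (∈-insertAfter⁺ w y∈w))
    ... | false | here refl = here refl
    ... | false | there y∈w = there (∈-insertAfter⁺ w y∈w)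

    ∈-insertAfter⁻ : ∀ {y} w → y ∈ insertAfter e t w → y ∈ w ⊎ y ≡ t
    ∈-insertAfter⁻ (a ∷ w) y∈ with e a | y∈
    ... | true | here refl = inj₁ (here refl)
    ... | true | there (here refl) = inj₂ refl
    ... | true | there (there y∈′) = Data.Sum.map₁ there (∈-insertAfter⁻ w y∈′)
    ... | false | here refl = inj₁ (here refl)
    ... | false | there y∈′ = Data.Sum.map₁ there (∈-insertAfter⁻ w y∈′)

    ∈-insertAfter-inserted : ∀ {b} w → b ∈ w → e b ≡ true → t ∈ insertAfter e t w
    ∈-insertAfter-inserted (a ∷ w) (here refl) eb rewrite eb = there (here refl)
    ∈-insertAfter-inserted (a ∷ w) (there b∈w) eb with e a
    ... | true = there (there (∈-insertAfter-inserted w b∈w eb))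
    ... | false = there (∈-insertAfter-inserted w b∈w eb)

    allᵇ-insertAfter : ∀ (P : A → Bool) w → P t ≡ true → allᵇ P (insertAfter e t w) ≡ allᵇ P w
    allᵇ-insertAfter P [] Pt = refl
    allᵇ-insertAfter P (a ∷ w) Pt with e a
    ... | true rewrite Pt = cong (P a ∧_) (allᵇ-insertAfter P w Pt)
    ... | false = cong (P a ∧_) (allᵇ-insertAfter P w Pt)

    filterᵇ-insertAfter : ∀ (P : A → Bool) w → P t ≡ false → filterᵇ P (insertAfter e t w) ≡ filterᵇ P w
    filterᵇ-insertAfter P [] Pt = refl
    filterᵇ-insertAfter P (a ∷ w) Pt with e a
    ... | true rewrite Pt with P a
    ...   | true = cong (a ∷_) (filterᵇ-insertAfter P w Pt)
    ...   | false = filterᵇ-insertAfter P w Pt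
    filterᵇ-insertAfter P (a ∷ w) Pt | false with P a
    ...   | true = cong (a ∷_) (filterᵇ-insertAfter P w Pt)
    ...   | false = filterᵇ-insertAfter P w Pt

    module _ (atMostOne : AtMostOne e) where

      private
        others-false : ∀ {a} w → e a ≡ true → a ∉ w → ∀ {b} → b ∈ w → e b ≡ false
        others-false w ea a∉w {b} b∈w with e b in eb
        ... | true = ⊥-elim (a∉w (subst (_∈ w) (atMostOne eb ea) b∈w))
        ... | false = refl

      length-insertAfter≤ : ∀ w → Unique w → length (insertAfter e t w) ≤ suc (length w)
      length-insertAfter≤ [] u = z≤n
      length-insertAfter≤ (a ∷ w) u@(_ ∷ uw) with e a in ea
      ... | true rewrite insertAfter-id w (others-false w ea (Unique[x∷xs]⇒x∉xs u)) = ℕ.≤-refl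
      ... | false = s≤s (length-insertAfter≤ w uw)

      Unique-insertAfter : ∀ w → Unique w → t ∉ w → Unique (insertAfter e t w)
      Unique-insertAfter [] u t∉w = []
      Unique-insertAfter (a ∷ w) u@(_ ∷ uw) t∉w with e a in ea
      ... | true rewrite insertAfter-id w (others-false w ea (Unique[x∷xs]⇒x∉xs u)) =
            ∷-Unique (λ { (here refl) → t∉w (here refl) ; (there a∈w) → Unique[x∷xs]⇒x∉xs u a∈w }) (∷-Unique (t∉w ∘ there) uw)
      ... | false = ∷-Unique a∉ (Unique-insertAfter w uw (t∉w ∘ there))
        where
        a∉ : a ∉ insertAfter e t w
        a∉ a∈ with ∈-insertAfter⁻ w a∈
        ... | inj₁ a∈w = Unique[x∷xs]⇒x∉xs u a∈w
        ... | inj₂ refl = t∉w (here refl)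

  map-insertAfter : ∀ {A B : Set} (e : A → Bool) (e′ : B → Bool) (f : A → B) t w → (∀ a → e a ≡ e′ (f a)) →
                    map f (insertAfter e t w) ≡ insertAfter e′ (f t) (map f w)
  map-insertAfter e e′ f t [] h = refl
  map-insertAfter e e′ f t (a ∷ w) h rewrite h a with e′ (f a)
  ... | true = cong (λ z → f a ∷ f t ∷ z) (map-insertAfter e e′ f t w h)
  ... | false = cong (f a ∷_) (map-insertAfter e e′ f t w h)

  module _ {n} {f g : Fin n → Fin n} (f≗g : f ≗ g) where

    orbit-cong : ∀ k s c → orbit f k s c ≡ orbit g k s c
    orbit-cong zero s c = refl
    orbit-cong (suc k) s c with toℕ c ≡ᵇ toℕ s
    ... | true = refl
    ... | false = cong (c ∷_) (trans (cong (orbit f k s) (f≗g c)) (orbit-cong k s (g c)))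

    cycleOf-cong : cycleOf f ≗ cycleOf g
    cycleOf-cong i = cong (i ∷_) (trans (cong (orbit f n i) (f≗g i)) (orbit-cong n i (g i)))

    isCycleMin-cong : isCycleMin f ≗ isCycleMin g
    isCycleMin-cong i = cong (allᵇ _) (cycleOf-cong i)

    Ψ-cong : Ψ f ≡ Ψ g
    Ψ-cong = trans (cong (concatMap (cycleOf f)) (filterᵇ-cong (reverse (allFin n)) (λ {i} _ → isCycleMin-cong i)))
                   (List.concatMap-cong cycleOf-cong (filterᵇ (isCycleMin g) (reverse (allFin n))))

    cyc-cong : cyc f ≡ cyc g
    cyc-cong = cong length (filterᵇ-cong (allFin n) (λ {i} _ → isCycleMin-cong i))

    cinv-cong : cinv f ≡ cinv g
    cinv-cong = trans (invWord≗ (Ψ f)) (cong (invWord g) Ψ-cong)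
      where
      invWord≗ : ∀ w → invWord f w ≡ invWord g w
      invWord≗ [] = refl
      invWord≗ (a ∷ w) = cong (_ +_) (invWord≗ w)

  -- A fuel-free description of orbit.
  data Orbit {n} (f : Fin n → Fin n) (s : Fin n) : Fin n → List (Fin n) → Set where
    stop : Orbit f s s []
    step : ∀ {c L} → c ≢ s → Orbit f s (f c) L → Orbit f s c (c ∷ L)

  Orbit-resp-≗ : ∀ {n} {f g : Fin n → Fin n} {s c L} → f ≗ g → Orbit f s c L → Orbit g s c L
  Orbit-resp-≗ f≗g stop = stop
  Orbit-resp-≗ {g = g} {s} f≗g (step {c} c≢s o) = step c≢s (subst (λ z → Orbit g s z _) (f≗g c) (Orbit-resp-≗ f≗g o))

  Orbit⇒orbit : ∀ {n} {f : Fin n → Fin n} {s c L} → Orbit f s c L → ∀ k → length L ≤ k → orbit f k s c ≡ L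
  Orbit⇒orbit stop zero _ = refl
  Orbit⇒orbit {s = s} stop (suc k) _ rewrite ≡ᵇ-refl (toℕ s) = refl
  Orbit⇒orbit {s = s} (step {c} c≢s o) (suc k) (s≤s L≤k) rewrite ≢⇒=ᶠ-false c≢s = cong (c ∷_) (Orbit⇒orbit o k L≤k)

  length-orbit≤ : ∀ {n} (f : Fin n → Fin n) k s c → length (orbit f k s c) ≤ k
  length-orbit≤ f zero s c = z≤n
  length-orbit≤ f (suc k) s c with toℕ c ≡ᵇ toℕ s
  ... | true = z≤n
  ... | false = s≤s (length-orbit≤ f k s (f c))

  -- extend σ c inserts the new largest letter n into the cycle of σ right after c
  -- (as a fixed point when c = n).
  extend : ∀ {n} → (Fin n → Fin n) → Fin (suc n) → Fin (suc n) → Fin (suc n)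
  extend {n} σ c = caseLast (λ i → if inject₁ i =ᶠ c then fromℕ n else inject₁ (σ i))
                            (caseLast (inject₁ ∘ σ) (fromℕ n) c)

  module _ {n} (σ : Fin n → Fin n) where

    extend-inject₁-≡ : ∀ {c} i → inject₁ i ≡ c → extend σ c (inject₁ i) ≡ fromℕ n
    extend-inject₁-≡ i refl = trans (caseLast-inject₁ _ _ i) (if-true (=ᶠ-refl (inject₁ i)))

    extend-inject₁-≢ : ∀ {c} i → inject₁ i ≢ c → extend σ c (inject₁ i) ≡ inject₁ (σ i)
    extend-inject₁-≢ i i≢c = trans (caseLast-inject₁ _ _ i) (if-false (≢⇒=ᶠ-false i≢c))

    extend-fromℕ-fromℕ : extend σ (fromℕ n) (fromℕ n) ≡ fromℕ n
    extend-fromℕ-fromℕ = trans (caseLast-fromℕ n _ _) (caseLast-fromℕ n _ _)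

    extend-inject₁-fromℕ : ∀ j → extend σ (inject₁ j) (fromℕ n) ≡ inject₁ (σ j)
    extend-inject₁-fromℕ j = trans (caseLast-fromℕ n _ _) (caseLast-inject₁ _ _ j)

    extend-c : ∀ c → extend σ c c ≡ fromℕ n
    extend-c c with view c
    ... | ‵fromℕ = extend-fromℕ-fromℕ
    ... | ‵inject₁ j = extend-inject₁-≡ j refl

    extend-≡fromℕ⇒ : ∀ c k → extend σ c k ≡ fromℕ n → k ≡ c
    extend-≡fromℕ⇒ c k eq with view k | view c
    ... | ‵inject₁ i | _ with inject₁ i Fin.≟ c
    ...   | yes i≡c = i≡c
    ...   | no i≢c = ⊥-elim (inject₁≢fromℕ (σ i) (trans (sym (extend-inject₁-≢ i i≢c)) eq))
    extend-≡fromℕ⇒ c k eq | ‵fromℕ | ‵fromℕ = refl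
    extend-≡fromℕ⇒ c k eq | ‵fromℕ | ‵inject₁ j = ⊥-elim (inject₁≢fromℕ (σ j) (trans (sym (extend-inject₁-fromℕ j)) eq))

    Orbit-extend-inject₁ : ∀ c {s c′ L} → Orbit σ s c′ L →
                           Orbit (extend σ c) (inject₁ s) (inject₁ c′) (insertAfter (_=ᶠ c) (fromℕ n) (map inject₁ L))
    Orbit-extend-inject₁ c stop = stop
    Orbit-extend-inject₁ c {s} (step {c′} {L} c′≢s o) with inject₁ c′ =ᶠ c in eq
    ... | true = step (c′≢s ∘ Fin.inject₁-injective)
                  (subst (λ z → Orbit π (inject₁ s) z (fromℕ n ∷ rest)) (sym (extend-inject₁-≡ c′ (=ᶠ⇒≡ eq)))
                    (step (inject₁≢fromℕ s ∘ sym)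
                      (subst (λ z → Orbit π (inject₁ s) z rest) (sym top↦) (Orbit-extend-inject₁ c o))))
      where
      π = extend σ c
      rest = insertAfter (_=ᶠ c) (fromℕ n) (map inject₁ L)
      top↦ : π (fromℕ n) ≡ inject₁ (σ c′)
      top↦ = subst (λ z → extend σ z (fromℕ n) ≡ inject₁ (σ c′)) (=ᶠ⇒≡ eq) (extend-inject₁-fromℕ c′)
    ... | false = step (c′≢s ∘ Fin.inject₁-injective)
                   (subst (λ z → Orbit (extend σ c) (inject₁ s) z _) (sym (extend-inject₁-≢ c′ (=ᶠ-false⇒≢ eq)))
                     (Orbit-extend-inject₁ c o))

    Orbit-extend-fromℕ : ∀ j {c′ L} → Orbit σ j c′ L →
                         Orbit (extend σ (inject₁ j)) (fromℕ n) (inject₁ c′) (map inject₁ L ++ [ inject₁ j ])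
    Orbit-extend-fromℕ j stop = step (inject₁≢fromℕ j) (subst (λ z → Orbit (extend σ (inject₁ j)) (fromℕ n) z []) (sym (extend-inject₁-≡ j refl)) stop)
    Orbit-extend-fromℕ j (step {c′} c′≢j o) =
      step (inject₁≢fromℕ c′)
           (subst (λ z → Orbit (extend σ (inject₁ j)) (fromℕ n) z _) (sym (extend-inject₁-≢ c′ (c′≢j ∘ Fin.inject₁-injective))) (Orbit-extend-fromℕ j o))

  -- C is the cycle of i under π, with a certificate that the fuel of orbit suffices.
  record IsCycleOf {m} (π : Fin m → Fin m) (i : Fin m) (C : List (Fin m)) : Set where
    constructor isCycleOf
    field
      {rest} : List (Fin m)
      rest-Orbit : Orbit π i (π i) rest
      rest-length : length rest ≤ m
      C≡i∷rest : C ≡ i ∷ rest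

  module _ {m} {π : Fin m → Fin m} {i C} (c : IsCycleOf π i C) where
    open IsCycleOf c

    IsCycleOf⇒cycleOf : cycleOf π i ≡ C
    IsCycleOf⇒cycleOf = trans (cong (i ∷_) (Orbit⇒orbit rest-Orbit m rest-length)) (sym C≡i∷rest)

    IsCycleOf⇒Orbit : Orbit π i (π i) (orbit π m i (π i))
    IsCycleOf⇒Orbit = subst (Orbit π i (π i)) (sym (Orbit⇒orbit rest-Orbit m rest-length)) rest-Orbit

  IsCycleOf-resp-≗ : ∀ {m} {π π′ : Fin m → Fin m} {i C} → π ≗ π′ → IsCycleOf π i C → IsCycleOf π′ i C
  IsCycleOf-resp-≗ {π′ = π′} {i} π≗π′ (isCycleOf o len eq) = isCycleOf (subst (λ z → Orbit π′ i z _) (π≗π′ i) (Orbit-resp-≗ π≗π′ o)) len eq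

  -- An invariant of every permutation in Sn, proved by induction along extend.
  record CycleFormSound {n} (σ : Fin n → Fin n) : Set where
    field
      cycle : ∀ i → IsCycleOf σ i (cycleOf σ i)
      cycleOf-Unique : ∀ i → Unique (cycleOf σ i)
      Ψ-Unique : Unique (Ψ σ)
      Ψ-complete : ∀ a → a ∈ Ψ σ

  CycleFormSound-resp-≗ : ∀ {n} {σ σ′ : Fin n → Fin n} → σ ≗ σ′ → CycleFormSound σ → CycleFormSound σ′
  CycleFormSound-resp-≗ σ≗σ′ S = record
    { cycle = λ i → subst (IsCycleOf _ i) (cycleOf-cong σ≗σ′ i) (IsCycleOf-resp-≗ σ≗σ′ (cycle i))
    ; cycleOf-Unique = λ i → subst Unique (cycleOf-cong σ≗σ′ i) (cycleOf-Unique i)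
    ; Ψ-Unique = subst Unique (Ψ-cong σ≗σ′) Ψ-Unique
    ; Ψ-complete = λ a → subst (a ∈_) (Ψ-cong σ≗σ′) (Ψ-complete a)
    }
    where open CycleFormSound S

  CycleFormSound-Fin0 : (σ : Fin 0 → Fin 0) → CycleFormSound σ
  CycleFormSound-Fin0 σ = record { cycle = λ () ; cycleOf-Unique = λ () ; Ψ-Unique = [] ; Ψ-complete = λ () }

  module CyclesOfExtend {n} (σ : Fin n → Fin n) (S : CycleFormSound σ) where
    open CycleFormSound S

    private
      top : Fin (suc n)
      top = fromℕ n

      tail : Fin n → List (Fin n)
      tail i = orbit σ n i (σ i)

      tail-Orbit : ∀ i → Orbit σ i (σ i) (tail i)
      tail-Orbit i = IsCycleOf⇒Orbit (cycle i)

      length-map-tail≤ : ∀ i → length (map inject₁ (tail i)) ≤ n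
      length-map-tail≤ i = subst (_≤ n) (sym (List.length-map inject₁ (tail i))) (length-orbit≤ σ n i (σ i))

      atMostOne : ∀ (c : Fin (suc n)) → AtMostOne (_=ᶠ c)
      atMostOne c ea eb = trans (=ᶠ⇒≡ ea) (sym (=ᶠ⇒≡ eb))

    IsCycleOf-extend-inject₁ : ∀ c i → IsCycleOf (extend σ c) (inject₁ i) (insertAfter (_=ᶠ c) top (map inject₁ (cycleOf σ i)))
    IsCycleOf-extend-inject₁ c i with inject₁ i Fin.≟ c
    ... | yes refl = isCycleOf
      (subst (λ z → Orbit π (inject₁ i) z (top ∷ rest)) (sym (extend-inject₁-≡ σ i refl))
        (step (inject₁≢fromℕ i ∘ sym)
          (subst (λ z → Orbit π (inject₁ i) z rest) (sym (extend-inject₁-fromℕ σ i)) (Orbit-extend-inject₁ σ c (tail-Orbit i)))))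
      (s≤s (subst (_≤ n) (sym (cong length rest≡)) (length-map-tail≤ i)))
      (insertAfter-∷-true (_=ᶠ c) top (map inject₁ (tail i)) (=ᶠ-refl (inject₁ i)))
      where
      π = extend σ c
      rest = insertAfter (_=ᶠ c) top (map inject₁ (tail i))
      rest≡ : rest ≡ map inject₁ (tail i)
      rest≡ = insertAfter-id (_=ᶠ c) top (map inject₁ (tail i)) λ a∈ →
        let (x , x∈ , a≡) = ∈-map⁻ inject₁ a∈
        in subst (λ z → (z =ᶠ inject₁ i) ≡ false) (sym a≡)
                 (≢⇒=ᶠ-false (λ x≡i → Unique[x∷xs]⇒x∉xs (cycleOf-Unique i) (subst (_∈ tail i) (Fin.inject₁-injective x≡i) x∈)))
    ... | no i≢c = isCycleOf
      (subst (λ z → Orbit (extend σ c) (inject₁ i) z (insertAfter (_=ᶠ c) top (map inject₁ (tail i))))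
             (sym (extend-inject₁-≢ σ i i≢c)) (Orbit-extend-inject₁ σ c (tail-Orbit i)))
      (ℕ.≤-trans (length-insertAfter≤ (_=ᶠ c) top (atMostOne c) (map inject₁ (tail i))
                                      (Unique.map⁺ Fin.inject₁-injective (Unique-∷⁻ (cycleOf-Unique i))))
                 (s≤s (length-map-tail≤ i)))
      (insertAfter-∷-false (_=ᶠ c) top (map inject₁ (tail i)) (≢⇒=ᶠ-false i≢c))

    IsCycleOf-extend-fromℕ : IsCycleOf (extend σ top) top [ top ]
    IsCycleOf-extend-fromℕ = isCycleOf (subst (λ z → Orbit (extend σ top) top z []) (sym (extend-fromℕ-fromℕ σ)) stop) z≤n refl

    IsCycleOf-extend-inject₁-fromℕ : ∀ j → IsCycleOf (extend σ (inject₁ j)) top (top ∷ map inject₁ (tail j) ++ [ inject₁ j ])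
    IsCycleOf-extend-inject₁-fromℕ j = isCycleOf
      (subst (λ z → Orbit (extend σ (inject₁ j)) top z (map inject₁ (tail j) ++ [ inject₁ j ])) (sym (extend-inject₁-fromℕ σ j))
        (Orbit-extend-fromℕ σ j (tail-Orbit j)))
      (subst (_≤ suc n) (sym len) (s≤s (length-map-tail≤ j)))
      refl
      where
      len : length (map inject₁ (tail j) ++ [ inject₁ j ]) ≡ suc (length (map inject₁ (tail j)))
      len = trans (List.length-++ (map inject₁ (tail j))) (ℕ.+-comm _ 1)

    cycleOf-extend-inject₁ : ∀ c i → cycleOf (extend σ c) (inject₁ i) ≡ insertAfter (_=ᶠ c) top (map inject₁ (cycleOf σ i))
    cycleOf-extend-inject₁ c i = IsCycleOf⇒cycleOf (IsCycleOf-extend-inject₁ c i)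

    isCycleMin-extend-inject₁ : ∀ c i → isCycleMin (extend σ c) (inject₁ i) ≡ isCycleMin σ i
    isCycleMin-extend-inject₁ c i = begin
      allᵇ P (cycleOf (extend σ c) (inject₁ i))                          ≡⟨ cong (allᵇ P) (cycleOf-extend-inject₁ c i) ⟩
      allᵇ P (insertAfter (_=ᶠ c) top (map inject₁ (cycleOf σ i)))    ≡⟨ allᵇ-insertAfter (_=ᶠ c) top P (map inject₁ (cycleOf σ i)) P-top ⟩
      allᵇ P (map inject₁ (cycleOf σ i))                                 ≡⟨ allᵇ-map P inject₁ (cycleOf σ i) ⟩
      allᵇ (P ∘ inject₁) (cycleOf σ i)                                   ≡⟨ allᵇ-cong (cycleOf σ i) (λ {x} _ → cong₂ _≤ᵇ_ (Fin.toℕ-inject₁ i) (Fin.toℕ-inject₁ x)) ⟩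
      isCycleMin σ i                                                     ∎
      where
      open ≡-Reasoning
      P : Fin (suc n) → Bool
      P j = toℕ (inject₁ i) ≤ᵇ toℕ j
      P-top : P top ≡ true
      P-top = ≤⇒≤ᵇ-true (subst₂ _≤_ (sym (Fin.toℕ-inject₁ i)) (sym (Fin.toℕ-fromℕ n)) (ℕ.<⇒≤ (Fin.toℕ<n i)))

    isCycleMin-extend-fromℕ : isCycleMin (extend σ top) top ≡ true
    isCycleMin-extend-fromℕ = trans (cong (allᵇ (λ j → toℕ top ≤ᵇ toℕ j)) (IsCycleOf⇒cycleOf IsCycleOf-extend-fromℕ))
                                    (cong (_∧ true) (≤⇒≤ᵇ-true (ℕ.≤-refl {toℕ top})))

    isCycleMin-extend-inject₁-fromℕ : ∀ j → isCycleMin (extend σ (inject₁ j)) top ≡ false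
    isCycleMin-extend-inject₁-fromℕ j with isCycleMin (extend σ (inject₁ j)) top in isMin
    ... | false = refl
    ... | true = ⊥-elim (ℕ.<⇒≱ j<top (≤ᵇ-true⇒≤ (allᵇ-sound (λ y → toℕ top ≤ᵇ toℕ y) isMin j∈)))
      where
      j<top : toℕ (inject₁ j) < toℕ top
      j<top = subst₂ _<_ (sym (Fin.toℕ-inject₁ j)) (sym (Fin.toℕ-fromℕ n)) (Fin.toℕ<n j)
      j∈ : inject₁ j ∈ cycleOf (extend σ (inject₁ j)) top
      j∈ = subst (inject₁ j ∈_) (sym (IsCycleOf⇒cycleOf (IsCycleOf-extend-inject₁-fromℕ j)))
                 (there (∈-++⁺ʳ (map inject₁ (tail j)) (here refl)))

    private
      concatMap-cycleOf-extend : ∀ c X → concatMap (cycleOf (extend σ c)) (map inject₁ X) ≡ insertAfter (_=ᶠ c) top (map inject₁ (concatMap (cycleOf σ) X))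
      concatMap-cycleOf-extend c [] = refl
      concatMap-cycleOf-extend c (x ∷ X) =
        trans (cong₂ _++_ (cycleOf-extend-inject₁ c x) (concatMap-cycleOf-extend c X))
              (trans (sym (insertAfter-++ (_=ᶠ c) top (map inject₁ (cycleOf σ x)) _))
                     (cong (insertAfter (_=ᶠ c) top) (sym (List.map-++ inject₁ (cycleOf σ x) _))))

      filter-isCycleMin-extend : ∀ c X → filterᵇ (isCycleMin (extend σ c)) (map inject₁ X) ≡ map inject₁ (filterᵇ (isCycleMin σ) X)
      filter-isCycleMin-extend c X = trans (filterᵇ-map _ inject₁ X) (cong (map inject₁) (filterᵇ-cong X (λ {i} _ → isCycleMin-extend-inject₁ c i)))

      -- top is the largest letter, so when it is a cycle minimum its cycle is listed first.
      Ψ-extend : ∀ c → Ψ (extend σ c) ≡ concatMap (cycleOf (extend σ c)) (filterᵇ (isCycleMin (extend σ c)) [ top ])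
                                          ++ insertAfter (_=ᶠ c) top (map inject₁ (Ψ σ))
      Ψ-extend c = begin
        concatMap (cycleOf π) (filterᵇ (isCycleMin π) (reverse (allFin (suc n))))
          ≡⟨ cong (concatMap (cycleOf π) ∘ filterᵇ (isCycleMin π)) (reverse-allFin-suc n) ⟩
        concatMap (cycleOf π) (filterᵇ (isCycleMin π) ([ top ] ++ map inject₁ R))
          ≡⟨ cong (concatMap (cycleOf π)) (filterᵇ-++ (isCycleMin π) [ top ] (map inject₁ R)) ⟩
        concatMap (cycleOf π) (filterᵇ (isCycleMin π) [ top ] ++ filterᵇ (isCycleMin π) (map inject₁ R))
          ≡⟨ List.concatMap-++ (cycleOf π) (filterᵇ (isCycleMin π) [ top ]) (filterᵇ (isCycleMin π) (map inject₁ R)) ⟩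
        concatMap (cycleOf π) (filterᵇ (isCycleMin π) [ top ]) ++ concatMap (cycleOf π) (filterᵇ (isCycleMin π) (map inject₁ R))
          ≡⟨ cong (λ z → cycleTop ++ concatMap (cycleOf π) z) (filter-isCycleMin-extend c R) ⟩
        concatMap (cycleOf π) (filterᵇ (isCycleMin π) [ top ]) ++ concatMap (cycleOf π) (map inject₁ (filterᵇ (isCycleMin σ) R))
          ≡⟨ cong (cycleTop ++_) (concatMap-cycleOf-extend c (filterᵇ (isCycleMin σ) R)) ⟩
        concatMap (cycleOf π) (filterᵇ (isCycleMin π) [ top ]) ++ insertAfter (_=ᶠ c) top (map inject₁ (Ψ σ)) ∎
        where
        open ≡-Reasoning
        π = extend σ c
        R = reverse (allFin n)
        cycleTop = concatMap (cycleOf π) (filterᵇ (isCycleMin π) [ top ])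

    Ψ-extend-fromℕ : Ψ (extend σ top) ≡ top ∷ map inject₁ (Ψ σ)
    Ψ-extend-fromℕ = begin
      Ψ (extend σ top)
        ≡⟨ Ψ-extend top ⟩
      concatMap (cycleOf (extend σ top)) (filterᵇ (isCycleMin (extend σ top)) [ top ]) ++ insertAfter (_=ᶠ top) top (map inject₁ (Ψ σ))
        ≡⟨ cong₂ _++_ (cong (concatMap (cycleOf (extend σ top))) (filterᵇ-∷-true (isCycleMin (extend σ top)) [] isCycleMin-extend-fromℕ))
                      (insertAfter-id (_=ᶠ top) top (map inject₁ (Ψ σ))
                         (λ {a} a∈ → ≢⇒=ᶠ-false {a = a} {b = top} (λ { refl → fromℕ∉map-inject₁ (Ψ σ) a∈ }))) ⟩
      (cycleOf (extend σ top) top ++ []) ++ map inject₁ (Ψ σ)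
        ≡⟨ cong (_++ map inject₁ (Ψ σ)) (trans (List.++-identityʳ (cycleOf (extend σ top) top)) (IsCycleOf⇒cycleOf IsCycleOf-extend-fromℕ)) ⟩
      top ∷ map inject₁ (Ψ σ) ∎
      where open ≡-Reasoning

    Ψ-extend-inject₁ : ∀ j → Ψ (extend σ (inject₁ j)) ≡ insertAfter (_=ᶠ inject₁ j) top (map inject₁ (Ψ σ))
    Ψ-extend-inject₁ j = trans (Ψ-extend (inject₁ j))
      (cong (λ z → concatMap (cycleOf π) z ++ insertAfter (_=ᶠ inject₁ j) top (map inject₁ (Ψ σ)))
            (filterᵇ-∷-false (isCycleMin π) [] (isCycleMin-extend-inject₁-fromℕ j)))
      where π = extend σ (inject₁ j)

    private
      cyc-extend : ∀ c → cyc (extend σ c) ≡ cyc σ + length (filterᵇ (isCycleMin (extend σ c)) [ top ])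
      cyc-extend c = begin
        length (filterᵇ P (allFin (suc n)))                                  ≡⟨ cong (length ∘ filterᵇ P) (allFin-suc n) ⟩
        length (filterᵇ P (map inject₁ (allFin n) ++ [ top ]))               ≡⟨ cong length (filterᵇ-++ P (map inject₁ (allFin n)) [ top ]) ⟩
        length (filterᵇ P (map inject₁ (allFin n)) ++ filterᵇ P [ top ])     ≡⟨ List.length-++ (filterᵇ P (map inject₁ (allFin n))) ⟩
        length (filterᵇ P (map inject₁ (allFin n))) + length (filterᵇ P [ top ])
          ≡⟨ cong (λ z → length z + length (filterᵇ P [ top ])) (filter-isCycleMin-extend c (allFin n)) ⟩
        length (map inject₁ (filterᵇ (isCycleMin σ) (allFin n))) + length (filterᵇ P [ top ])
          ≡⟨ cong (_+ length (filterᵇ P [ top ])) (List.length-map inject₁ (filterᵇ (isCycleMin σ) (allFin n))) ⟩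
        cyc σ + length (filterᵇ P [ top ]) ∎
        where
        open ≡-Reasoning
        P = isCycleMin (extend σ c)

    cyc-extend-fromℕ : cyc (extend σ top) ≡ suc (cyc σ)
    cyc-extend-fromℕ = trans (cyc-extend top)
      (trans (cong (λ z → cyc σ + length z) (filterᵇ-∷-true (isCycleMin (extend σ top)) [] isCycleMin-extend-fromℕ)) (ℕ.+-comm (cyc σ) 1))

    cyc-extend-inject₁ : ∀ j → cyc (extend σ (inject₁ j)) ≡ cyc σ
    cyc-extend-inject₁ j = trans (cyc-extend (inject₁ j))
      (trans (cong (λ z → cyc σ + length z) (filterᵇ-∷-false (isCycleMin (extend σ (inject₁ j))) [] (isCycleMin-extend-inject₁-fromℕ j)))
             (ℕ.+-identityʳ (cyc σ)))

    CycleFormSound-extend : ∀ c → CycleFormSound (extend σ c)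
    CycleFormSound-extend c = record
      { cycle = cycle′ ; cycleOf-Unique = cycleOf-Unique′ ; Ψ-Unique = Ψ-Unique′ ; Ψ-complete = Ψ-complete′ }
      where
      π = extend σ c

      cycle′ : ∀ k → IsCycleOf π k (cycleOf π k)
      cycle′ k with view k | view c
      ... | ‵inject₁ i | _ = subst (IsCycleOf π (inject₁ i)) (sym (cycleOf-extend-inject₁ c i)) (IsCycleOf-extend-inject₁ c i)
      ... | ‵fromℕ | ‵fromℕ = subst (IsCycleOf π top) (sym (IsCycleOf⇒cycleOf IsCycleOf-extend-fromℕ)) IsCycleOf-extend-fromℕ
      ... | ‵fromℕ | ‵inject₁ j = subst (IsCycleOf π top) (sym (IsCycleOf⇒cycleOf (IsCycleOf-extend-inject₁-fromℕ j))) (IsCycleOf-extend-inject₁-fromℕ j)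

      Unique-map-inject₁ : ∀ {w} → Unique w → Unique (map inject₁ w)
      Unique-map-inject₁ = Unique.map⁺ Fin.inject₁-injective

      cycleOf-Unique′ : ∀ k → Unique (cycleOf π k)
      cycleOf-Unique′ k with view k | view c
      ... | ‵inject₁ i | _ = subst Unique (sym (cycleOf-extend-inject₁ c i))
              (Unique-insertAfter (_=ᶠ c) top (atMostOne c) _ (Unique-map-inject₁ (cycleOf-Unique i)) (fromℕ∉map-inject₁ (cycleOf σ i)))
      ... | ‵fromℕ | ‵fromℕ = subst Unique (sym (IsCycleOf⇒cycleOf IsCycleOf-extend-fromℕ)) ([] ∷ [])
      ... | ‵fromℕ | ‵inject₁ j =
              subst Unique (sym (trans (IsCycleOf⇒cycleOf (IsCycleOf-extend-inject₁-fromℕ j)) (cong (top ∷_) (sym (List.map-++ inject₁ (tail j) [ j ])))))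
              (∷-Unique (fromℕ∉map-inject₁ (tail j ++ [ j ])) (Unique-map-inject₁ (Unique-∷ʳ (cycleOf-Unique j))))

      Ψ-Unique′ : Unique (Ψ π)
      Ψ-Unique′ with view c
      ... | ‵fromℕ = subst Unique (sym Ψ-extend-fromℕ) (∷-Unique (fromℕ∉map-inject₁ (Ψ σ)) (Unique-map-inject₁ Ψ-Unique))
      ... | ‵inject₁ j = subst Unique (sym (Ψ-extend-inject₁ j))
              (Unique-insertAfter (_=ᶠ inject₁ j) top (atMostOne (inject₁ j)) _ (Unique-map-inject₁ Ψ-Unique) (fromℕ∉map-inject₁ (Ψ σ)))

      Ψ-complete′ : ∀ a → a ∈ Ψ π
      Ψ-complete′ a with view c | view a
      ... | ‵fromℕ | ‵fromℕ = subst (top ∈_) (sym Ψ-extend-fromℕ) (here refl)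
      ... | ‵fromℕ | ‵inject₁ i = subst (inject₁ i ∈_) (sym Ψ-extend-fromℕ) (there (∈-map⁺ inject₁ (Ψ-complete i)))
      ... | ‵inject₁ j | ‵fromℕ = subst (top ∈_) (sym (Ψ-extend-inject₁ j))
              (∈-insertAfter-inserted (_=ᶠ inject₁ j) top (map inject₁ (Ψ σ)) (∈-map⁺ inject₁ (Ψ-complete j)) (=ᶠ-refl (inject₁ j)))
      ... | ‵inject₁ j | ‵inject₁ i = subst (inject₁ i ∈_) (sym (Ψ-extend-inject₁ j))
              (∈-insertAfter⁺ (_=ᶠ inject₁ j) top (map inject₁ (Ψ σ)) (∈-map⁺ inject₁ (Ψ-complete i)))

  injectiveᵇ⇒Injective : ∀ {n m} (v : Vec (Fin n) m) → injectiveᵇ v ≡ true → Injective _≡_ _≡_ (lookup v)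
  injectiveᵇ⇒Injective {n} {m} v h {i} {j} vi≡vj = =ᶠ⇒≡ (or-not (allᵇ-sound _ (allᵇ-sound _ h (∈-allFin i)) (∈-allFin j)))
    where
    or-not : ((i =ᶠ j) ∨ not (lookup v i =ᶠ lookup v j)) ≡ true → (i =ᶠ j) ≡ true
    or-not rewrite vi≡vj | =ᶠ-refl (lookup v j) | ∨-identityʳ (i =ᶠ j) = id

  Injective⇒injectiveᵇ : ∀ {n m} (v : Vec (Fin n) m) → Injective _≡_ _≡_ (lookup v) → injectiveᵇ v ≡ true
  Injective⇒injectiveᵇ {n} {m} v inj = allᵇ-complete _ (allFin m) λ {i} _ → allᵇ-complete _ (allFin m) λ {j} _ → pair-ok i j
    where
    pair-ok : ∀ i j → ((i =ᶠ j) ∨ not (lookup v i =ᶠ lookup v j)) ≡ true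
    pair-ok i j with lookup v i =ᶠ lookup v j in eq
    ... | true rewrite inj (=ᶠ⇒≡ eq) | =ᶠ-refl j = refl
    ... | false = ∨-zeroʳ (i =ᶠ j)

  ∈-allVecs : ∀ {A : Set} (xs : List A) m (v : Vec A m) → (∀ i → lookup v i ∈ xs) → v ∈ allVecs xs m
  ∈-allVecs xs zero Vec.[] h = here refl
  ∈-allVecs xs (suc m) (a Vec.∷ v) h =
    ∈-concatMap⁺ (λ a → map (a Vec.∷_) (allVecs xs m)) (lose (h Fin.zero) (∈-map⁺ (a Vec.∷_) (∈-allVecs xs m v (h ∘ Fin.suc))))

  Unique-allVecs : ∀ {A : Set} (xs : List A) m → Unique xs → Unique (allVecs xs m)
  Unique-allVecs xs zero u = [] ∷ []
  Unique-allVecs xs (suc m) u =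
    Unique-concatMap (λ a → map (a Vec.∷_) (allVecs xs m)) Vec.head u
      (λ a → Unique.map⁺ Vec.∷-injectiveʳ (Unique-allVecs xs m u))
      (λ {a} y∈ → let (_ , _ , y≡) = ∈-map⁻ (a Vec.∷_) y∈ in cong Vec.head y≡)

  ∈-Sn⁺ : ∀ n (v : Vec (Fin n) n) → Injective _≡_ _≡_ (lookup v) → v ∈ Sn n
  ∈-Sn⁺ n v inj = ∈-filterᵇ⁺ injectiveᵇ (∈-allVecs (allFin n) n v (∈-allFin ∘ lookup v)) (Injective⇒injectiveᵇ v inj)

  ∈-Sn⁻ : ∀ n (v : Vec (Fin n) n) → v ∈ Sn n → Injective _≡_ _≡_ (lookup v)
  ∈-Sn⁻ n v v∈ = injectiveᵇ⇒Injective v (proj₂ (∈-filterᵇ⁻ injectiveᵇ {xs = allVecs (allFin n) n} v∈))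

  Unique-Sn : ∀ n → Unique (Sn n)
  Unique-Sn n = Unique-filterᵇ injectiveᵇ (Unique-allVecs (allFin n) n (Unique.allFin⁺ n))

  findOr : ∀ {A : Set} → (A → Bool) → A → List A → A
  findOr P d [] = d
  findOr P d (x ∷ xs) = if P x then x else findOr P d xs

  module _ {A : Set} where

    findOr-unique : ∀ (P : A → Bool) d {c} xs → (∀ {k} → P k ≡ true → k ≡ c) → c ∈ xs → P c ≡ true → findOr P d xs ≡ c
    findOr-unique P d (x ∷ xs) unique c∈ Pc with P x in Px | c∈
    ... | true | _ = unique Px
    ... | false | here refl with () ← trans (sym Px) Pc
    ... | false | there c∈xs = findOr-unique P d xs unique c∈xs Pc

    findOr-sound : ∀ (P : A → Bool) d {x} xs → x ∈ xs → P x ≡ true → P (findOr P d xs) ≡ true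
    findOr-sound P d (y ∷ xs) x∈ Px with P y in Py | x∈
    ... | true | _ = Py
    ... | false | here refl with () ← trans (sym Py) Px
    ... | false | there x∈xs = findOr-sound P d xs x∈xs Px

    findOr-cong : ∀ {P Q : A → Bool} d xs → P ≗ Q → findOr P d xs ≡ findOr Q d xs
    findOr-cong d [] P≗Q = refl
    findOr-cong {Q = Q} d (x ∷ xs) P≗Q rewrite P≗Q x with Q x
    ... | true = refl
    ... | false = findOr-cong d xs P≗Q

  -- Inverse of extend: restrict w removes the letter n from the cycle form of w,
  -- and preimageTop w is the letter that extend has to insert n after.
  module _ {n : ℕ} where

    private
      top : Fin (suc n)
      top = fromℕ n

    lowerOr : Fin n → Fin (suc n) → Fin n
    lowerOr d = caseLast id d

    inject₁-lowerOr : ∀ d k → k ≢ top → inject₁ (lowerOr d k) ≡ k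
    inject₁-lowerOr d k k≢top with view k
    ... | ‵inject₁ i = cong inject₁ (caseLast-inject₁ id d i)
    ... | ‵fromℕ = ⊥-elim (k≢top refl)

    restrict : (Fin (suc n) → Fin (suc n)) → Fin n → Fin n
    restrict w i = lowerOr i (if w (inject₁ i) =ᶠ top then w top else w (inject₁ i))

    preimageTop : (Fin (suc n) → Fin (suc n)) → Fin (suc n)
    preimageTop w = findOr (λ k → w k =ᶠ top) top (allFin (suc n))

    preimageTop-sound : ∀ (w : Fin (suc n) → Fin (suc n)) → (∃ λ k → w k ≡ top) → w (preimageTop w) ≡ top
    preimageTop-sound w (k , wk≡top) =
      =ᶠ⇒≡ {a = w (preimageTop w)} {b = top} (findOr-sound (λ k → w k =ᶠ top) top (allFin (suc n)) (∈-allFin k) (trans (cong (_=ᶠ top) wk≡top) (=ᶠ-refl top)))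

    Injective⇒top-has-preimage : ∀ (w : Fin (suc n) → Fin (suc n)) → Injective _≡_ _≡_ w → ∃ λ k → w k ≡ top
    Injective⇒top-has-preimage w inj with Fin.any? (λ k → w k Fin.≟ top)
    ... | yes hit = hit
    ... | no miss with Fin.pigeonhole (ℕ.n<1+n n) w′
      where
      w′ : Fin (suc n) → Fin n
      w′ k = Fin.lower₁ (w k) (λ n≡ → miss (k , Fin.toℕ-injective (trans (sym n≡) (sym (Fin.toℕ-fromℕ n)))))
    ...   | i , j , i<j , w′i≡w′j = ⊥-elim (Fin.<⇒≢ i<j (inj (trans (sym (Fin.inject₁-lower₁ (w i) _))
                                                            (trans (cong inject₁ w′i≡w′j) (Fin.inject₁-lower₁ (w j) _)))))

    module _ (σ : Fin n → Fin n) where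

      preimageTop-extend : ∀ c → preimageTop (extend σ c) ≡ c
      preimageTop-extend c = findOr-unique (λ k → extend σ c k =ᶠ top) top (allFin (suc n))
        (λ {k} e → extend-≡fromℕ⇒ σ c k (=ᶠ⇒≡ e)) (∈-allFin c) (trans (cong (_=ᶠ top) (extend-c σ c)) (=ᶠ-refl top))

      restrict-extend : ∀ c → restrict (extend σ c) ≗ σ
      restrict-extend c i with inject₁ i Fin.≟ c
      ... | yes refl =
        trans (cong (λ z → lowerOr i (if z =ᶠ top then extend σ (inject₁ i) top else z)) (extend-inject₁-≡ σ i refl))
          (trans (cong (lowerOr i) (if-true {x = extend σ (inject₁ i) top} {y = top} (=ᶠ-refl top)))
            (trans (cong (lowerOr i) (extend-inject₁-fromℕ σ i)) (caseLast-inject₁ id i (σ i))))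
      ... | no i≢c =
        trans (cong (λ z → lowerOr i (if z =ᶠ top then extend σ c top else z)) (extend-inject₁-≢ σ i i≢c))
          (trans (cong (lowerOr i) (if-false {x = extend σ c top} {y = inject₁ (σ i)} (≢⇒=ᶠ-false (inject₁≢fromℕ (σ i)))))
            (caseLast-inject₁ id i (σ i)))

      Source : Fin (suc n) → Fin (suc n) → Fin n → Set
      Source c k m = (k ≡ inject₁ m) ⊎ (k ≡ top × c ≡ inject₁ m)

      extend-source : ∀ c k → k ≢ c → Σ (Fin n) λ m → extend σ c k ≡ inject₁ (σ m) × Source c k m
      extend-source c k k≢c with view k | view c
      ... | ‵inject₁ i | _ = i , extend-inject₁-≢ σ i k≢c , inj₁ refl
      ... | ‵fromℕ | ‵inject₁ j = j , extend-inject₁-fromℕ σ j , inj₂ (refl , refl)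
      ... | ‵fromℕ | ‵fromℕ = ⊥-elim (k≢c refl)

      extend-injective : Injective _≡_ _≡_ σ → ∀ c → Injective _≡_ _≡_ (extend σ c)
      extend-injective inj c {k} {k′} eq with k Fin.≟ c | k′ Fin.≟ c
      ... | yes k≡c | yes k′≡c = trans k≡c (sym k′≡c)
      ... | yes refl | no _ = sym (extend-≡fromℕ⇒ σ k k′ (trans (sym eq) (extend-c σ k)))
      ... | no _ | yes refl = extend-≡fromℕ⇒ σ k′ k (trans eq (extend-c σ k′))
      ... | no k≢c | no k′≢c with extend-source c k k≢c | extend-source c k′ k′≢c
      ...   | m , ek , sk | m′ , ek′ , sk′ = same-source (inj (Fin.inject₁-injective (trans (sym ek) (trans eq ek′)))) sk sk′
        where
        same-source : m ≡ m′ → Source c k m → Source c k′ m′ → k ≡ k′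
        same-source refl (inj₁ a) (inj₁ b) = trans a (sym b)
        same-source refl (inj₁ a) (inj₂ (_ , b)) = ⊥-elim (k≢c (trans a (sym b)))
        same-source refl (inj₂ (_ , a)) (inj₁ b) = ⊥-elim (k′≢c (trans b (sym a)))
        same-source refl (inj₂ (a , _)) (inj₂ (b , _)) = trans a (sym b)

      extend-injective⁻ : ∀ c → Injective _≡_ _≡_ (extend σ c) → Injective _≡_ _≡_ σ
      extend-injective⁻ c inj {i} {i′} eq with inject₁ i Fin.≟ c | inject₁ i′ Fin.≟ c
      ... | yes i≡c | yes i′≡c = Fin.inject₁-injective (trans i≡c (sym i′≡c))
      ... | no i≢c | no i′≢c = Fin.inject₁-injective (inj
            (trans (extend-inject₁-≢ σ i i≢c) (trans (cong inject₁ eq) (sym (extend-inject₁-≢ σ i′ i′≢c)))))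
      ... | yes refl | no i′≢c = ⊥-elim (inject₁≢fromℕ i′ (sym (inj
            (trans (extend-inject₁-fromℕ σ i) (trans (cong inject₁ eq) (sym (extend-inject₁-≢ σ i′ i′≢c)))))))
      ... | no i≢c | yes refl = ⊥-elim (inject₁≢fromℕ i (sym (inj
            (trans (extend-inject₁-fromℕ σ i′) (trans (cong inject₁ (sym eq)) (sym (extend-inject₁-≢ σ i i≢c)))))))

    module _ (w : Fin (suc n) → Fin (suc n)) (inj : Injective _≡_ _≡_ w) where

      private
        w-pre : w (preimageTop w) ≡ top
        w-pre = preimageTop-sound w (Injective⇒top-has-preimage w inj)

      extend-restrict : extend (restrict w) (preimageTop w) ≗ w
      extend-restrict k with k Fin.≟ preimageTop w
      ... | yes refl = trans (extend-c (restrict w) k) (sym w-pre)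
      ... | no k≢pre with extend-source (restrict w) (preimageTop w) k k≢pre
      ...   | m , ek , inj₁ refl =
                trans ek (trans (cong (inject₁ ∘ lowerOr m) (if-false {x = w top} (≢⇒=ᶠ-false wm≢top))) (inject₁-lowerOr m (w k) wm≢top))
        where
        wm≢top : w (inject₁ m) ≢ top
        wm≢top wm≡top = k≢pre (inj (trans wm≡top (sym w-pre)))
      ...   | m , ek , inj₂ (refl , pre≡m) =
                trans ek (trans (cong (inject₁ ∘ lowerOr m) (if-true {y = w (inject₁ m)} wm=top)) (inject₁-lowerOr m (w top) wtop≢top))
        where
        wm=top : (w (inject₁ m) =ᶠ top) ≡ true
        wm=top = trans (cong (λ z → w z =ᶠ top) (sym pre≡m)) (trans (cong (_=ᶠ top) w-pre) (=ᶠ-refl top))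
        wtop≢top : w top ≢ top
        wtop≢top wtop≡top = k≢pre (inj (trans wtop≡top (sym w-pre)))

  module _ {n : ℕ} where

    extend-cong : ∀ {σ σ′ : Fin n → Fin n} → σ ≗ σ′ → ∀ c → extend σ c ≗ extend σ′ c
    extend-cong σ≗σ′ c = caseLast-cong (λ i → cong (if inject₁ i =ᶠ c then fromℕ n else_) (cong inject₁ (σ≗σ′ i)))
                                       (caseLast-cong (cong inject₁ ∘ σ≗σ′) refl c)

    restrict-cong : ∀ {w w′ : Fin (suc n) → Fin (suc n)} → w ≗ w′ → restrict w ≗ restrict w′
    restrict-cong w≗w′ i = cong₂ (λ a b → lowerOr i (if a =ᶠ fromℕ n then b else a)) (w≗w′ (inject₁ i)) (w≗w′ (fromℕ n))

    preimageTop-cong : ∀ {w w′ : Fin (suc n) → Fin (suc n)} → w ≗ w′ → preimageTop w ≡ preimageTop w′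
    preimageTop-cong w≗w′ = findOr-cong (fromℕ n) (allFin (suc n)) (cong (_=ᶠ fromℕ n) ∘ w≗w′)

    extendV : Vec (Fin n) n → Fin (suc n) → Vec (Fin (suc n)) (suc n)
    extendV v c = Vec.tabulate (extend (lookup v) c)

    restrictV : Vec (Fin (suc n)) (suc n) → Vec (Fin n) n
    restrictV w = Vec.tabulate (restrict (lookup w))

    lookup-extendV : ∀ v c → lookup (extendV v c) ≗ extend (lookup v) c
    lookup-extendV v c = Vec.lookup∘tabulate (extend (lookup v) c)

    restrictV-extendV : ∀ v c → restrictV (extendV v c) ≡ v
    restrictV-extendV v c =
      trans (Vec.tabulate-cong (λ i → trans (restrict-cong (lookup-extendV v c) i) (restrict-extend (lookup v) c i))) (Vec.tabulate∘lookup v)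

    preimageTop-extendV : ∀ v c → preimageTop (lookup (extendV v c)) ≡ c
    preimageTop-extendV v c = trans (preimageTop-cong (lookup-extendV v c)) (preimageTop-extend (lookup v) c)

    extendV-restrictV : ∀ w → Injective _≡_ _≡_ (lookup w) → extendV (restrictV w) (preimageTop (lookup w)) ≡ w
    extendV-restrictV w inj = trans
      (Vec.tabulate-cong (λ k → trans (extend-cong (Vec.lookup∘tabulate (restrict (lookup w))) (preimageTop (lookup w)) k) (extend-restrict (lookup w) inj k)))
      (Vec.tabulate∘lookup w)

  Injective-resp-≗ : ∀ {A B : Set} {f g : A → B} → f ≗ g → Injective _≡_ _≡_ f → Injective _≡_ _≡_ g
  Injective-resp-≗ f≗g inj {i} {j} gi≡gj = inj (trans (f≗g i) (trans gi≡gj (sym (f≗g j))))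

  extensions : ∀ n → List (Vec (Fin (suc n)) (suc n))
  extensions n = concatMap (λ v → map (extendV v) (allFin (suc n))) (Sn n)

  Sn-suc↭extensions : ∀ n → Sn (suc n) ↭ extensions n
  Sn-suc↭extensions n = Unique-⊆-⊇⇒↭ (Unique-Sn (suc n)) Unique-extensions ⊆ ⊇
    where
    extensionsOf : Vec (Fin n) n → List (Vec (Fin (suc n)) (suc n))
    extensionsOf v = map (extendV v) (allFin (suc n))

    Unique-extensions : Unique (extensions n)
    Unique-extensions = Unique-concatMap extensionsOf restrictV (Unique-Sn n)
      (λ v → Unique.map⁺ (λ {c} {c′} eq → trans (sym (preimageTop-extendV v c))
                                                 (trans (cong (preimageTop ∘ lookup) eq) (preimageTop-extendV v c′)))
                         (Unique.allFin⁺ (suc n)))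
      (λ {v} y∈ → let (c , _ , y≡) = ∈-map⁻ (extendV v) y∈ in trans (cong restrictV y≡) (restrictV-extendV v c))

    ⊆ : ∀ {w} → w ∈ Sn (suc n) → w ∈ extensions n
    ⊆ {w} w∈ = subst (_∈ extensions n) (extendV-restrictV w inj)
      (∈-concatMap⁺ extensionsOf (lose (∈-Sn⁺ n (restrictV w) restrictV-inj)
                                       (∈-map⁺ (extendV (restrictV w)) (∈-allFin (preimageTop (lookup w))))))
      where
      inj : Injective _≡_ _≡_ (lookup w)
      inj = ∈-Sn⁻ (suc n) w w∈
      restrictV-inj : Injective _≡_ _≡_ (lookup (restrictV w))
      restrictV-inj = Injective-resp-≗ (sym ∘ Vec.lookup∘tabulate (restrict (lookup w)))
        (extend-injective⁻ (restrict (lookup w)) (preimageTop (lookup w)) (Injective-resp-≗ (sym ∘ extend-restrict (lookup w) inj) inj))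

    ⊇ : ∀ {w} → w ∈ extensions n → w ∈ Sn (suc n)
    ⊇ w∈ with find (∈-concatMap⁻ extensionsOf {xs = Sn n} w∈)
    ... | v , v∈ , y∈ with ∈-map⁻ (extendV v) y∈
    ...   | c , _ , refl = ∈-Sn⁺ (suc n) (extendV v c)
            (Injective-resp-≗ (sym ∘ lookup-extendV v c) (extend-injective (lookup v) (∈-Sn⁻ n v v∈) c))

  CycleFormSound-Sn : ∀ n (v : Vec (Fin n) n) → v ∈ Sn n → CycleFormSound (lookup v)
  CycleFormSound-Sn zero v _ = CycleFormSound-Fin0 (lookup v)
  CycleFormSound-Sn (suc n) v v∈
    with find (∈-concatMap⁻ (λ v → map (extendV v) (allFin (suc n))) {xs = Sn n} (↭.∈-resp-↭ (Sn-suc↭extensions n) v∈))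
  ... | v′ , v′∈ , y∈ with ∈-map⁻ (extendV v′) y∈
  ...   | c , _ , refl = CycleFormSound-resp-≗ (sym ∘ lookup-extendV v′ c)
                           (CyclesOfExtend.CycleFormSound-extend (lookup v′) (CycleFormSound-Sn n v′ v′∈) c)

  inversions : List ℕ → ℕ
  inversions [] = 0
  inversions (a ∷ w) = length (filterᵇ (_<ᵇ a) w) + inversions w

  invWord≡inversions : ∀ {n} (π : Fin n → Fin n) w → invWord π w ≡ inversions (map toℕ w)
  invWord≡inversions π [] = refl
  invWord≡inversions π (a ∷ w) = cong₂ _+_
    (sym (trans (cong length (filterᵇ-map (_<ᵇ toℕ a) toℕ w)) (List.length-map toℕ (filterᵇ (λ b → toℕ b <ᵇ toℕ a) w))))
    (invWord≡inversions π w)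

  cinv≡inversions : ∀ {n} (π : Fin n → Fin n) → cinv π ≡ inversions (map toℕ (Ψ π))
  cinv≡inversions π = invWord≡inversions π (Ψ π)

  lettersAfter : List ℕ → ℕ → ℕ
  lettersAfter [] b = 0
  lettersAfter (a ∷ w) b = if a ≡ᵇ b then length w else lettersAfter w b

  lettersAfter≤length : ∀ w b → lettersAfter w b ≤ length w
  lettersAfter≤length [] b = z≤n
  lettersAfter≤length (a ∷ w) b with a ≡ᵇ b
  ... | true = ℕ.n≤1+n (length w)
  ... | false = ℕ.m≤n⇒m≤1+n (lettersAfter≤length w b)

  map-lettersAfter : ∀ w → Unique w → map (lettersAfter w) w ≡ downFrom (length w)
  map-lettersAfter [] u = refl
  map-lettersAfter (a ∷ w) u@(_ ∷ uw) rewrite ≡ᵇ-refl a = cong (length w ∷_) (trans (List.map-cong-local (All.tabulate later)) (map-lettersAfter w uw))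
    where
    later : ∀ {b} → b ∈ w → lettersAfter (a ∷ w) b ≡ lettersAfter w b
    later {b} b∈w = if-false (≢⇒≡ᵇ-false {a} {b} λ { refl → Unique[x∷xs]⇒x∉xs u b∈w })

  -- Inserting a new largest letter t right after b creates one inversion with each letter after b.
  inversions-insertAfter : ∀ t b w → Unique w → (∀ {x} → x ∈ w → x < t) → b ∈ w →
                           inversions (insertAfter (_≡ᵇ b) t w) ≡ inversions w + lettersAfter w b
  inversions-insertAfter t b (a ∷ w) u@(_ ∷ uw) <t b∈ with a ≡ᵇ b in a=b
  ... | true rewrite insertAfter-id (_≡ᵇ b) t w
                       (λ {x} x∈w → ≢⇒≡ᵇ-false {x} {b} λ { refl → Unique[x∷xs]⇒x∉xs u (subst (_∈ w) (sym (≡ᵇ⇒≡ a=b)) x∈w) })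
                   | ≤⇒>ᵇ-false (ℕ.<⇒≤ (<t (here refl)))
                   | filterᵇ-all (_<ᵇ t) w (λ x∈ → <⇒<ᵇ-true (<t (there x∈))) =
    trans (cong (length (filterᵇ (_<ᵇ a) w) +_) (ℕ.+-comm (length w) (inversions w))) (sym (ℕ.+-assoc _ (inversions w) (length w)))
  ... | false = trans (cong₂ _+_ (cong length (filterᵇ-insertAfter (_≡ᵇ b) t (_<ᵇ a) w (≤⇒>ᵇ-false (ℕ.<⇒≤ (<t (here refl))))))
                                 (inversions-insertAfter t b w uw (<t ∘ there) (b∈w b∈)))
                      (sym (ℕ.+-assoc (length (filterᵇ (_<ᵇ a) w)) (inversions w) (lettersAfter w b)))
    where
    b∈w : b ∈ a ∷ w → b ∈ w
    b∈w (there b∈w) = b∈w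
    b∈w (here refl) with () ← trans (sym a=b) (≡ᵇ-refl a)

  suc-C2 : ∀ m → suc m C 2 ≡ m + m C 2
  suc-C2 m = trans (sym (nCk+nC[k+1]≡[n+1]C[k+1] m 1)) (cong (_+ m C 2) (nC1≡n m))

  inversions≤C2 : ∀ w → inversions w ≤ length w C 2
  inversions≤C2 [] = z≤n
  inversions≤C2 (a ∷ w) = subst (inversions (a ∷ w) ≤_) (sym (suc-C2 (length w)))
    (ℕ.+-mono-≤ (length-filterᵇ≤ (_<ᵇ a) w) (inversions≤C2 w))

  module StatisticsOfExtend {n} (σ : Fin n → Fin n) (S : CycleFormSound σ) where
    open CycleFormSound S
    open CyclesOfExtend σ S

    W : List ℕ
    W = map toℕ (Ψ σ)

    allFin↭Ψ : allFin n ↭ Ψ σ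
    allFin↭Ψ = Unique-⊆-⊇⇒↭ (Unique.allFin⁺ n) Ψ-Unique (λ {z} _ → Ψ-complete z) (λ {z} _ → ∈-allFin z)

    length-W : length W ≡ n
    length-W = trans (List.length-map toℕ (Ψ σ)) (trans (sym (↭.↭-length allFin↭Ψ)) (List.length-tabulate id))

    Unique-W : Unique W
    Unique-W = Unique.map⁺ Fin.toℕ-injective Ψ-Unique

    private
      W<n : ∀ {x} → x ∈ W → x < n
      W<n x∈ = let (a , _ , x≡) = ∈-map⁻ toℕ x∈ in subst (_< n) (sym x≡) (Fin.toℕ<n a)

      map-toℕ-inject₁ : ∀ (X : List (Fin n)) → map toℕ (map inject₁ X) ≡ map toℕ X
      map-toℕ-inject₁ X = trans (sym (List.map-∘ X)) (List.map-cong Fin.toℕ-inject₁ X)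

      +-∸-+ : ∀ A B a b → a ≤ A → b ≤ B → (B + A) ∸ (a + b) ≡ (A ∸ a) + (B ∸ b)
      +-∸-+ A B a b a≤A b≤B = begin
        (B + A) ∸ (a + b)   ≡⟨ cong ((B + A) ∸_) (ℕ.+-comm a b) ⟩
        (B + A) ∸ (b + a)   ≡⟨ ℕ.∸-+-assoc (B + A) b a ⟨
        (B + A) ∸ b ∸ a     ≡⟨ cong (_∸ a) (ℕ.+-∸-comm A b≤B) ⟩
        (B ∸ b + A) ∸ a     ≡⟨ ℕ.+-∸-assoc (B ∸ b) a≤A ⟩
        B ∸ b + (A ∸ a)     ≡⟨ ℕ.+-comm (B ∸ b) (A ∸ a) ⟩
        (A ∸ a) + (B ∸ b)   ∎
        where open ≡-Reasoning

    cinv-extend-fromℕ : cinv (extend σ (fromℕ n)) ≡ n + cinv σ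
    cinv-extend-fromℕ = begin
      cinv (extend σ (fromℕ n))                       ≡⟨ cinv≡inversions (extend σ (fromℕ n)) ⟩
      inversions (map toℕ (Ψ (extend σ (fromℕ n))))   ≡⟨ cong (inversions ∘ map toℕ) Ψ-extend-fromℕ ⟩
      inversions (map toℕ (fromℕ n ∷ map inject₁ (Ψ σ))) ≡⟨ cong₂ (λ t w → inversions (t ∷ w)) (Fin.toℕ-fromℕ n) (map-toℕ-inject₁ (Ψ σ)) ⟩
      length (filterᵇ (_<ᵇ n) W) + inversions W       ≡⟨ cong (_+ inversions W) (trans (cong length (filterᵇ-all (_<ᵇ n) W (<⇒<ᵇ-true ∘ W<n))) length-W) ⟩
      n + inversions W                                ≡⟨ cong (n +_) (cinv≡inversions σ) ⟨
      n + cinv σ                                      ∎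
      where open ≡-Reasoning

    cinv-extend-inject₁ : ∀ j → cinv (extend σ (inject₁ j)) ≡ cinv σ + lettersAfter W (toℕ j)
    cinv-extend-inject₁ j = begin
      cinv (extend σ (inject₁ j))                          ≡⟨ cinv≡inversions (extend σ (inject₁ j)) ⟩
      inversions (map toℕ (Ψ (extend σ (inject₁ j))))      ≡⟨ cong (inversions ∘ map toℕ) (Ψ-extend-inject₁ j) ⟩
      inversions (map toℕ (insertAfter (_=ᶠ inject₁ j) (fromℕ n) (map inject₁ (Ψ σ))))
        ≡⟨ cong inversions (map-insertAfter (_=ᶠ inject₁ j) (_≡ᵇ toℕ j) toℕ (fromℕ n) (map inject₁ (Ψ σ)) (λ a → cong (toℕ a ≡ᵇ_) (Fin.toℕ-inject₁ j))) ⟩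
      inversions (insertAfter (_≡ᵇ toℕ j) (toℕ (fromℕ n)) (map toℕ (map inject₁ (Ψ σ))))
        ≡⟨ cong₂ (λ t w → inversions (insertAfter (_≡ᵇ toℕ j) t w)) (Fin.toℕ-fromℕ n) (map-toℕ-inject₁ (Ψ σ)) ⟩
      inversions (insertAfter (_≡ᵇ toℕ j) n W)             ≡⟨ inversions-insertAfter n (toℕ j) W Unique-W W<n (∈-map⁺ toℕ (Ψ-complete j)) ⟩
      inversions W + lettersAfter W (toℕ j)                ≡⟨ cong (_+ lettersAfter W (toℕ j)) (cinv≡inversions σ) ⟨
      cinv σ + lettersAfter W (toℕ j)                      ∎
      where open ≡-Reasoning

    non-extend-fromℕ : non (extend σ (fromℕ n)) ≡ non σ
    non-extend-fromℕ = trans (cong₂ _∸_ (suc-C2 n) cinv-extend-fromℕ) (ℕ.[m+n]∸[m+o]≡n∸o n (n C 2) (cinv σ))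

    non-extend-inject₁ : ∀ j → non (extend σ (inject₁ j)) ≡ non σ + (n ∸ lettersAfter W (toℕ j))
    non-extend-inject₁ j = trans (cong₂ _∸_ (suc-C2 n) (cinv-extend-inject₁ j))
      (+-∸-+ (n C 2) n (cinv σ) (lettersAfter W (toℕ j)) cinv≤C2 (subst (lettersAfter W (toℕ j) ≤_) length-W (lettersAfter≤length W (toℕ j))))
      where
      cinv≤C2 : cinv σ ≤ n C 2
      cinv≤C2 = subst₂ _≤_ (sym (cinv≡inversions σ)) (cong (_C 2) length-W) (inversions≤C2 W)

open Permutations

module FiniteSums {c ℓ} (R : CommutativeRing c ℓ) where
  open CommutativeRing R hiding (zero)
  open Series R
  open import Relation.Binary.Reasoning.Setoid setoid

  sumList-↭ : ∀ {xs ys} → xs ↭ ys → sumList xs ≈ sumList ys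
  sumList-↭ p = ↭ₛ.foldr-commMonoid setoid +-isCommutativeMonoid (↭⇒↭ₛ′ isEquivalence p)

  sumList-++ : ∀ xs ys → sumList (xs ++ ys) ≈ sumList xs + sumList ys
  sumList-++ [] ys = sym (+-identityˡ _)
  sumList-++ (a ∷ xs) ys = trans (+-congˡ (sumList-++ xs ys)) (sym (+-assoc a _ _))

  sumList-concatMap : ∀ {A B : Set} (g : B → Carrier) (f : A → List B) xs →
                      sumList (map g (concatMap f xs)) ≈ sumList (map (λ a → sumList (map g (f a))) xs)
  sumList-concatMap g f [] = refl
  sumList-concatMap g f (a ∷ xs) = begin
    sumList (map g (f a ++ concatMap f xs))                      ≡⟨ ≡.cong sumList (List.map-++ g (f a) (concatMap f xs)) ⟩
    sumList (map g (f a) ++ map g (concatMap f xs))              ≈⟨ sumList-++ (map g (f a)) (map g (concatMap f xs)) ⟩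
    sumList (map g (f a)) + sumList (map g (concatMap f xs))     ≈⟨ +-congˡ (sumList-concatMap g f xs) ⟩
    sumList (map (λ a → sumList (map g (f a))) (a ∷ xs))         ∎

  sumList-cong : ∀ {A : Set} {g h : A → Carrier} xs → (∀ {a} → a ∈ xs → g a ≈ h a) → sumList (map g xs) ≈ sumList (map h xs)
  sumList-cong [] g≈h = refl
  sumList-cong (a ∷ xs) g≈h = +-cong (g≈h (here ≡.refl)) (sumList-cong xs (g≈h ∘ there))

  sumList-*ʳ : ∀ {A : Set} (g : A → Carrier) b xs → sumList (map (λ a → g a * b) xs) ≈ sumList (map g xs) * b
  sumList-*ʳ g b [] = sym (zeroˡ b)
  sumList-*ʳ g b (a ∷ xs) = trans (+-congˡ (sumList-*ʳ g b xs)) (sym (distribʳ b (g a) _))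

  sumList-*ˡ : ∀ {A : Set} (g : A → Carrier) b xs → sumList (map (λ a → b * g a) xs) ≈ b * sumList (map g xs)
  sumList-*ˡ g b [] = sym (zeroʳ b)
  sumList-*ˡ g b (a ∷ xs) = trans (+-congˡ (sumList-*ˡ g b xs)) (sym (distribˡ b (g a) _))

  sumList-downFrom : ∀ (h : ℕ → Carrier) m → sumList (map h (downFrom m)) ≈ sumTo m h
  sumList-downFrom h zero = refl
  sumList-downFrom h (suc m) = trans (+-congˡ (sumList-downFrom h m)) (+-comm (h m) _)

  pow-+ : ∀ a m k → pow a (m ℕ.+ k) ≈ pow a m * pow a k
  pow-+ a zero k = sym (*-identityˡ _)
  pow-+ a (suc m) k = trans (*-congˡ (pow-+ a m k)) (sym (*-assoc a _ _))

module WeightSum {c ℓ} (R : CommutativeRing c ℓ) (p q x : CommutativeRing.Carrier R) where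
  open CommutativeRing R hiding (zero)
  open PQX R p q x
  open FiniteSums R
  open import Relation.Binary.Reasoning.Setoid setoid
  open import Algebra.Solver.Ring.NaturalCoefficients.Default commutativeSemiring

  weightOf : ∀ {n} → (Fin n → Fin n) → Carrier
  weightOf σ = pow p (non σ) * pow q (cinv σ) * pow x (cyc σ)

  weightOf-cong : ∀ {n} {σ σ′ : Fin n → Fin n} → σ ≗ σ′ → weightOf σ ≡ weightOf σ′
  weightOf-cong {n} σ≗σ′ = ≡.cong₂ (λ i k → pow p (n C 2 ℕ.∸ i) * pow q i * pow x k) (cinv-cong σ≗σ′) (cyc-cong σ≗σ′)

  weightOf-≡ : ∀ {n} (σ : Fin n → Fin n) {a b k} → non σ ≡ a → cinv σ ≡ b → cyc σ ≡ k → weightOf σ ≡ pow p a * pow q b * pow x k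
  weightOf-≡ σ ≡.refl ≡.refl ≡.refl = ≡.refl

  module _ {n} (σ : Fin n → Fin n) (S : CycleFormSound σ) where
    open CyclesOfExtend σ S
    open StatisticsOfExtend σ S

    weightOf-extend-fromℕ : weightOf (extend σ (fromℕ n)) ≈ weightOf σ * (x * pow q n)
    weightOf-extend-fromℕ = begin
      weightOf π
        ≡⟨ weightOf-≡ π non-extend-fromℕ cinv-extend-fromℕ cyc-extend-fromℕ ⟩
      pow p (non σ) * pow q (n ℕ.+ cinv σ) * (x * pow x (cyc σ))
        ≈⟨ *-congʳ (*-congˡ (pow-+ q n (cinv σ))) ⟩
      pow p (non σ) * (pow q n * pow q (cinv σ)) * (x * pow x (cyc σ))
        ≈⟨ solve 5 (λ P Qn Qi X Xc → P :* (Qn :* Qi) :* (X :* Xc) := (P :* Qi :* Xc) :* (X :* Qn)) refl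
                 (pow p (non σ)) (pow q n) (pow q (cinv σ)) x (pow x (cyc σ)) ⟩
      weightOf σ * (x * pow q n) ∎
      where π = extend σ (fromℕ n)

    -- The summand of [n+1] indexed by the number k of letters after the insertion point.
    term : ℕ → Carrier
    term k = pow p (n ℕ.∸ k) * pow q k

    weightOf-extend-inject₁ : ∀ j → weightOf (extend σ (inject₁ j)) ≈ weightOf σ * term (lettersAfter W (toℕ j))
    weightOf-extend-inject₁ j = begin
      weightOf π
        ≡⟨ weightOf-≡ π (non-extend-inject₁ j) (cinv-extend-inject₁ j) (cyc-extend-inject₁ j) ⟩
      pow p (non σ ℕ.+ (n ℕ.∸ k)) * pow q (cinv σ ℕ.+ k) * pow x (cyc σ)
        ≈⟨ *-congʳ (*-cong (pow-+ p (non σ) (n ℕ.∸ k)) (pow-+ q (cinv σ) k)) ⟩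
      (pow p (non σ) * pow p (n ℕ.∸ k)) * (pow q (cinv σ) * pow q k) * pow x (cyc σ)
        ≈⟨ solve 5 (λ P Pd Qi Qk Xc → (P :* Pd) :* (Qi :* Qk) :* Xc := (P :* Qi :* Xc) :* (Pd :* Qk)) refl
                 (pow p (non σ)) (pow p (n ℕ.∸ k)) (pow q (cinv σ)) (pow q k) (pow x (cyc σ)) ⟩
      weightOf σ * term k ∎
      where
      π = extend σ (inject₁ j)
      k = lettersAfter W (toℕ j)

    -- Summing over the n+1 insertion points multiplies the weight by [n+1]_{p,q,x}:
    -- the letters after the insertion point run through 0, …, n-1 exactly once.
    sum-weightOf-extend : sumList (map (weightOf ∘ extend σ) (allFin (suc n))) ≈ weightOf σ * bracket (suc n)
    sum-weightOf-extend = begin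
      sumList (map g (allFin (suc n)))
        ≡⟨ ≡.cong (sumList ∘ map g) (allFin-suc n) ⟩
      sumList (map g (map inject₁ (allFin n) ++ [ fromℕ n ]))
        ≡⟨ ≡.cong sumList (List.map-++ g (map inject₁ (allFin n)) [ fromℕ n ]) ⟩
      sumList (map g (map inject₁ (allFin n)) ++ [ g (fromℕ n) ])
        ≈⟨ sumList-++ (map g (map inject₁ (allFin n))) [ g (fromℕ n) ] ⟩
      sumList (map g (map inject₁ (allFin n))) + (g (fromℕ n) + 0#)
        ≈⟨ +-cong inserted-after-old (trans (+-identityʳ _) weightOf-extend-fromℕ) ⟩
      weightOf σ * sumTo n term + weightOf σ * (x * pow q n)
        ≈⟨ distribˡ (weightOf σ) _ _ ⟨
      weightOf σ * bracket (suc n) ∎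
      where
      g : Fin (suc n) → Carrier
      g = weightOf ∘ extend σ
      inserted-after-old : sumList (map g (map inject₁ (allFin n))) ≈ weightOf σ * sumTo n term
      inserted-after-old = begin
        sumList (map g (map inject₁ (allFin n)))
          ≡⟨ ≡.cong sumList (≡.sym (List.map-∘ (allFin n))) ⟩
        sumList (map (g ∘ inject₁) (allFin n))
          ≈⟨ sumList-cong (allFin n) (λ {j} _ → weightOf-extend-inject₁ j) ⟩
        sumList (map (λ j → weightOf σ * term (lettersAfter W (toℕ j))) (allFin n))
          ≈⟨ sumList-*ˡ (term ∘ lettersAfter W ∘ toℕ) (weightOf σ) (allFin n) ⟩
        weightOf σ * sumList (map (term ∘ lettersAfter W ∘ toℕ) (allFin n))
          ≈⟨ *-congˡ (sumList-↭ (↭.map⁺ (term ∘ lettersAfter W ∘ toℕ) allFin↭Ψ)) ⟩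
        weightOf σ * sumList (map (term ∘ lettersAfter W ∘ toℕ) (Ψ σ))
          ≡⟨ ≡.cong (λ z → weightOf σ * sumList z) (≡.trans (List.map-∘ (Ψ σ)) (≡.cong (map term) (List.map-∘ (Ψ σ)))) ⟩
        weightOf σ * sumList (map term (map (lettersAfter W) W))
          ≡⟨ ≡.cong (λ z → weightOf σ * sumList (map term z)) (≡.trans (map-lettersAfter W Unique-W) (≡.cong downFrom length-W)) ⟩
        weightOf σ * sumList (map term (downFrom n))
          ≈⟨ *-congˡ (sumList-downFrom term n) ⟩
        weightOf σ * sumTo n term ∎

  sum-weight-Sn-suc : ∀ n → sumList (map weight (Sn (suc n))) ≈ sumList (map weight (Sn n)) * bracket (suc n)
  sum-weight-Sn-suc n = begin
    sumList (map weight (Sn (suc n)))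
      ≈⟨ sumList-↭ (↭.map⁺ weight (Sn-suc↭extensions n)) ⟩
    sumList (map weight (extensions n))
      ≈⟨ sumList-concatMap weight (λ v → map (extendV v) (allFin (suc n))) (Sn n) ⟩
    sumList (map (λ v → sumList (map weight (map (extendV v) (allFin (suc n))))) (Sn n))
      ≈⟨ sumList-cong (Sn n) (λ {v} v∈ → sum-extensions-of v (CycleFormSound-Sn n v v∈)) ⟩
    sumList (map (λ v → weightOf (lookup v) * bracket (suc n)) (Sn n))
      ≈⟨ sumList-*ʳ (weightOf ∘ lookup) (bracket (suc n)) (Sn n) ⟩
    sumList (map weight (Sn n)) * bracket (suc n) ∎
    where
    sum-extensions-of : ∀ v → CycleFormSound (lookup v) →
                        sumList (map weight (map (extendV v) (allFin (suc n)))) ≈ weightOf (lookup v) * bracket (suc n)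
    sum-extensions-of v S = begin
      sumList (map weight (map (extendV v) (allFin (suc n))))
        ≡⟨ ≡.cong sumList (≡.trans (≡.sym (List.map-∘ (allFin (suc n)))) (List.map-cong (weightOf-cong ∘ lookup-extendV v) (allFin (suc n)))) ⟩
      sumList (map (weightOf ∘ extend (lookup v)) (allFin (suc n)))
        ≈⟨ sum-weightOf-extend (lookup v) S ⟩
      weightOf (lookup v) * bracket (suc n) ∎

  sum-weight-Sn : ∀ n → sumList (map weight (Sn n)) ≈ prod1To n bracket
  sum-weight-Sn zero = trans (+-identityʳ _) (trans (*-identityʳ _) (*-identityʳ _))
  sum-weight-Sn (suc n) = trans (sum-weight-Sn-suc n) (*-congʳ (sum-weight-Sn n))

  F≈G : ∀ n → F n ≈ G n
  F≈G zero = refl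
  F≈G (suc n) = sum-weight-Sn (suc n)

module PowerSeries {c ℓ} (R : CommutativeRing c ℓ) where
  open CommutativeRing R hiding (zero)
  open Series R
  open import Relation.Binary.Reasoning.Setoid setoid
  open import Algebra.Properties.Ring ring using ([y-z]x≈yx-zx)
  open import Algebra.Properties.AbelianGroup +-abelianGroup using (⁻¹-∙-comm; ⁻¹-anti-homo‿-)
  open import Algebra.Properties.Group +-group using (ε⁻¹≈ε; //-rightDividesˡ; //-rightDividesʳ; \\-leftDividesʳ)
  open import Algebra.Properties.CommutativeSemigroup +-commutativeSemigroup using (interchange)

  x-0≈x : ∀ x → x - 0# ≈ x
  x-0≈x x = trans (+-congˡ ε⁻¹≈ε) (+-identityʳ x)

  x+[y-x]≈y : ∀ x y → x + (y - x) ≈ y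
  x+[y-x]≈y x y = trans (+-comm x (y - x)) (//-rightDividesˡ x y)

  [x-z]-[y-z]≈x-y : ∀ x y z → (x - z) - (y - z) ≈ x - y
  [x-z]-[y-z]≈x-y x y z = begin
    (x - z) - (y - z)     ≈⟨ +-congˡ (⁻¹-anti-homo‿- y z) ⟩
    (x - z) + (z - y)     ≈⟨ +-assoc x (- z) (z - y) ⟩
    x + (- z + (z - y))   ≈⟨ +-congˡ (\\-leftDividesʳ z (- y)) ⟩
    x - y                 ∎

  x≈y+[x-z]⇒z≈y : ∀ x y z → x ≈ y + (x - z) → z ≈ y
  x≈y+[x-z]⇒z≈y x y z x≈ = begin
    z                         ≈⟨ x+[y-x]≈y x z ⟨
    x + (z - x)               ≈⟨ +-congˡ (⁻¹-anti-homo‿- x z) ⟨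
    x - (x - z)               ≈⟨ +-congʳ x≈ ⟩
    (y + (x - z)) - (x - z)   ≈⟨ //-rightDividesʳ (x - z) y ⟩
    y                         ∎

  sumTo-cong : ∀ m {f g : ℕ → Carrier} → (∀ {i} → i < m → f i ≈ g i) → sumTo m f ≈ sumTo m g
  sumTo-cong zero f≈g = refl
  sumTo-cong (suc m) f≈g = +-cong (sumTo-cong m (f≈g ∘ ℕ.m<n⇒m<1+n)) (f≈g (ℕ.n<1+n m))

  sumTo-suc : ∀ m (f : ℕ → Carrier) → sumTo (suc m) f ≈ f 0 + sumTo m (f ∘ suc)
  sumTo-suc zero f = trans (+-identityˡ _) (sym (+-identityʳ _))
  sumTo-suc (suc m) f = trans (+-congʳ (sumTo-suc m f)) (+-assoc _ _ _)

  sumTo-≈0 : ∀ m {f : ℕ → Carrier} → (∀ {i} → i < m → f i ≈ 0#) → sumTo m f ≈ 0#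
  sumTo-≈0 zero f≈0 = refl
  sumTo-≈0 (suc m) f≈0 = trans (+-cong (sumTo-≈0 m (f≈0 ∘ ℕ.m<n⇒m<1+n)) (f≈0 (ℕ.n<1+n m))) (+-identityʳ 0#)

  sumTo-+ : ∀ m (f g : ℕ → Carrier) → sumTo m (λ i → f i + g i) ≈ sumTo m f + sumTo m g
  sumTo-+ zero f g = sym (+-identityʳ 0#)
  sumTo-+ (suc m) f g = trans (+-congʳ (sumTo-+ m f g)) (interchange _ _ _ _)

  *-sumTo : ∀ m a (f : ℕ → Carrier) → a * sumTo m f ≈ sumTo m (λ i → a * f i)
  *-sumTo zero a f = zeroʳ a
  *-sumTo (suc m) a f = trans (distribˡ a _ _) (+-congʳ (*-sumTo m a f))

  -‿sumTo : ∀ m (f : ℕ → Carrier) → - sumTo m f ≈ sumTo m (λ i → - f i)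
  -‿sumTo zero f = ε⁻¹≈ε
  -‿sumTo (suc m) f = trans (sym (⁻¹-∙-comm _ _)) (+-congʳ (-‿sumTo m f))

  _≈ˢ_ : Ser → Ser → Set ℓ
  f ≈ˢ g = ∀ k → f k ≈ g k

  shift : Ser → Ser
  shift f i = f (suc i)

  ⊛-cong : ∀ {f f′ g g′} → f ≈ˢ f′ → g ≈ˢ g′ → (f ⊛ g) ≈ˢ (f′ ⊛ g′)
  ⊛-cong f≈ g≈ k = sumTo-cong (suc k) (λ {i} _ → *-cong (f≈ i) (g≈ (k ℕ.∸ i)))

  ⊛-coeff-cong : ∀ {f f′ g g′} k → (∀ {i} → i ≤ k → f i ≈ f′ i) → (∀ {i} → i ≤ k → g i ≈ g′ i) → (f ⊛ g) k ≈ (f′ ⊛ g′) k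
  ⊛-coeff-cong k f≈ g≈ = sumTo-cong (suc k) (λ {i} i<sk → *-cong (f≈ (ℕ.≤-pred i<sk)) (g≈ (ℕ.m∸n≤m k i)))

  ⊛-coeff₀ : ∀ f g → (f ⊛ g) 0 ≈ f 0 * g 0
  ⊛-coeff₀ f g = +-identityˡ _

  ⊛-coeff-suc : ∀ f g k → (f ⊛ g) (suc k) ≈ f 0 * g (suc k) + (shift f ⊛ g) k
  ⊛-coeff-suc f g k = sumTo-suc (suc k) _

  ⊛-coeff-sucʳ : ∀ f g k → (f ⊛ g) (suc k) ≈ (f ⊛ shift g) k + f (suc k) * g 0
  ⊛-coeff-sucʳ f g k = +-cong (sumTo-cong (suc k) (λ i<sk → *-congˡ (reflexive (≡.cong g (ℕ.+-∸-assoc 1 (ℕ.≤-pred i<sk))))))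
                              (*-congˡ (reflexive (≡.cong g (ℕ.n∸n≡0 k))))

  ⊛-comm : ∀ f g → (f ⊛ g) ≈ˢ (g ⊛ f)
  ⊛-comm f g zero = trans (⊛-coeff₀ f g) (trans (*-comm _ _) (sym (⊛-coeff₀ g f)))
  ⊛-comm f g (suc k) = begin
    (f ⊛ g) (suc k)                       ≈⟨ ⊛-coeff-suc f g k ⟩
    f 0 * g (suc k) + (shift f ⊛ g) k     ≈⟨ +-cong (*-comm _ _) (⊛-comm (shift f) g k) ⟩
    g (suc k) * f 0 + (g ⊛ shift f) k     ≈⟨ +-comm _ _ ⟩
    (g ⊛ shift f) k + g (suc k) * f 0     ≈⟨ ⊛-coeff-sucʳ g f k ⟨
    (g ⊛ f) (suc k)                       ∎

  ⊛-coeff≈0 : ∀ f k → (∀ {i} → i ≤ k → f i ≈ 0#) → ∀ g → (g ⊛ f) k ≈ 0#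
  ⊛-coeff≈0 f k f≈0 g = sumTo-≈0 (suc k) (λ {i} _ → trans (*-congˡ (f≈0 (ℕ.m∸n≤m k i))) (zeroʳ _))

  zeroS-⊛ : ∀ f → (zeroS ⊛ f) ≈ˢ zeroS
  zeroS-⊛ f k = sumTo-≈0 (suc k) (λ _ → zeroˡ _)

  oneS-⊛ : ∀ f → (oneS ⊛ f) ≈ˢ f
  oneS-⊛ f zero = trans (⊛-coeff₀ oneS f) (*-identityˡ _)
  oneS-⊛ f (suc k) = trans (⊛-coeff-suc oneS f k) (trans (+-cong (*-identityˡ _) (zeroS-⊛ f k)) (+-identityʳ _))

  ⊕-⊛ : ∀ f g h → ((f ⊕ g) ⊛ h) ≈ˢ ((f ⊛ h) ⊕ (g ⊛ h))
  ⊕-⊛ f g h k = trans (sumTo-cong (suc k) (λ _ → distribʳ _ _ _)) (sumTo-+ (suc k) _ _)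

  ⊛-⊕ : ∀ f g h → (f ⊛ (g ⊕ h)) ≈ˢ ((f ⊛ g) ⊕ (f ⊛ h))
  ⊛-⊕ f g h k = trans (sumTo-cong (suc k) (λ _ → distribˡ _ _ _)) (sumTo-+ (suc k) _ _)

  ⊖-⊛ : ∀ f g h → ((f ⊖ g) ⊛ h) ≈ˢ ((f ⊛ h) ⊖ (g ⊛ h))
  ⊖-⊛ f g h k = begin
    ((f ⊖ g) ⊛ h) k                                              ≈⟨ sumTo-cong (suc k) (λ _ → [y-z]x≈yx-zx _ _ _) ⟩
    sumTo (suc k) (λ i → f i * h (k ℕ.∸ i) - g i * h (k ℕ.∸ i))  ≈⟨ sumTo-+ (suc k) _ _ ⟩
    (f ⊛ h) k + sumTo (suc k) (λ i → - (g i * h (k ℕ.∸ i)))      ≈⟨ +-congˡ (-‿sumTo (suc k) _) ⟨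
    (f ⊛ h) k - (g ⊛ h) k                                        ∎

  scale-⊛ : ∀ a f g → ((λ i → a * f i) ⊛ g) ≈ˢ (λ k → a * (f ⊛ g) k)
  scale-⊛ a f g k = trans (sumTo-cong (suc k) (λ _ → *-assoc _ _ _)) (sym (*-sumTo (suc k) a _))

  ⊛-assoc : ∀ f g h → ((f ⊛ g) ⊛ h) ≈ˢ (f ⊛ (g ⊛ h))
  ⊛-assoc f g h zero = begin
    ((f ⊛ g) ⊛ h) 0        ≈⟨ ⊛-coeff₀ (f ⊛ g) h ⟩
    (f ⊛ g) 0 * h 0        ≈⟨ *-congʳ (⊛-coeff₀ f g) ⟩
    (f 0 * g 0) * h 0      ≈⟨ *-assoc _ _ _ ⟩
    f 0 * (g 0 * h 0)      ≈⟨ *-congˡ (⊛-coeff₀ g h) ⟨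
    f 0 * (g ⊛ h) 0        ≈⟨ ⊛-coeff₀ f (g ⊛ h) ⟨
    (f ⊛ (g ⊛ h)) 0        ∎
  ⊛-assoc f g h (suc k) = begin
    ((f ⊛ g) ⊛ h) (suc k)
      ≈⟨ ⊛-coeff-suc (f ⊛ g) h k ⟩
    (f ⊛ g) 0 * h (suc k) + (shift (f ⊛ g) ⊛ h) k
      ≈⟨ +-cong (*-congʳ (⊛-coeff₀ f g)) (⊛-cong {g = h} (⊛-coeff-suc f g) (λ _ → refl) k) ⟩
    (f 0 * g 0) * h (suc k) + ((f0·g′ ⊕ (shift f ⊛ g)) ⊛ h) k
      ≈⟨ +-congˡ (⊕-⊛ f0·g′ (shift f ⊛ g) h k) ⟩
    (f 0 * g 0) * h (suc k) + ((f0·g′ ⊛ h) k + ((shift f ⊛ g) ⊛ h) k)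
      ≈⟨ +-congˡ (+-cong (scale-⊛ (f 0) (shift g) h k) (⊛-assoc (shift f) g h k)) ⟩
    (f 0 * g 0) * h (suc k) + (f 0 * (shift g ⊛ h) k + (shift f ⊛ (g ⊛ h)) k)
      ≈⟨ +-assoc _ _ _ ⟨
    ((f 0 * g 0) * h (suc k) + f 0 * (shift g ⊛ h) k) + (shift f ⊛ (g ⊛ h)) k
      ≈⟨ +-congʳ (trans (+-congʳ (*-assoc _ _ _)) (sym (distribˡ (f 0) _ _))) ⟩
    f 0 * (g 0 * h (suc k) + (shift g ⊛ h) k) + (shift f ⊛ (g ⊛ h)) k
      ≈⟨ +-congʳ (*-congˡ (⊛-coeff-suc g h k)) ⟨
    f 0 * (g ⊛ h) (suc k) + (shift f ⊛ (g ⊛ h)) k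
      ≈⟨ ⊛-coeff-suc f (g ⊛ h) k ⟨
    (f ⊛ (g ⊛ h)) (suc k) ∎
    where
    f0·g′ : Ser
    f0·g′ i = f 0 * shift g i

  monoZ-⊛-coeff₀ : ∀ a f → (monoZ a ⊛ f) 0 ≈ 0#
  monoZ-⊛-coeff₀ a f = trans (⊛-coeff₀ (monoZ a) f) (zeroˡ _)

  monoZ-⊛-coeff-suc : ∀ a f k → (monoZ a ⊛ f) (suc k) ≈ a * f k
  monoZ-⊛-coeff-suc a f k = trans (⊛-coeff-suc (monoZ a) f k) (trans (+-cong (zeroˡ _) (constant-⊛ k)) (+-identityˡ _))
    where
    constant-⊛ : ∀ k → (shift (monoZ a) ⊛ f) k ≈ a * f k
    constant-⊛ zero = ⊛-coeff₀ (shift (monoZ a)) f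
    constant-⊛ (suc k) = trans (⊛-coeff-suc (shift (monoZ a)) f k) (trans (+-congˡ (zeroS-⊛ f k)) (+-identityʳ _))

  partialGeom : Ser → ℕ → Ser
  partialGeom g N k = sumTo N (λ j → powS g j k)

  partialGeom-suc : ∀ g N → partialGeom g (suc N) ≈ˢ (oneS ⊕ (g ⊛ partialGeom g N))
  partialGeom-suc g zero k = trans (+-comm 0# (oneS k)) (+-congˡ (sym (⊛-coeff≈0 (partialGeom g 0) k (λ _ → refl) g)))
  partialGeom-suc g (suc N) k = begin
    partialGeom g (suc N) k + powS g (suc N) k                         ≈⟨ +-congʳ (partialGeom-suc g N k) ⟩
    (oneS k + (g ⊛ partialGeom g N) k) + (g ⊛ powS g N) k              ≈⟨ +-assoc _ _ _ ⟩
    oneS k + ((g ⊛ partialGeom g N) k + (g ⊛ powS g N) k)              ≈⟨ +-congˡ (⊛-⊕ g (partialGeom g N) (powS g N) k) ⟨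
    oneS k + (g ⊛ partialGeom g (suc N)) k                             ∎

  powS-vanish : ∀ g → g 0 ≈ 0# → ∀ j {k} → k < j → powS g j k ≈ 0#
  powS-vanish g g₀≈0 (suc j) {zero} _ = trans (⊛-coeff₀ g (powS g j)) (trans (*-congʳ g₀≈0) (zeroˡ _))
  powS-vanish g g₀≈0 (suc j) {suc k} (s≤s k<j) =
    trans (⊛-coeff-suc g (powS g j) k)
          (trans (+-cong (trans (*-congʳ g₀≈0) (zeroˡ _))
                         (⊛-coeff≈0 (powS g j) k (λ i≤k → powS-vanish g g₀≈0 j (ℕ.≤-<-trans i≤k k<j)) (shift g)))
                 (+-identityˡ 0#))

  partialGeom-stable : ∀ g → g 0 ≈ 0# → ∀ N {k} → k < N → partialGeom g (suc N) k ≈ partialGeom g N k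
  partialGeom-stable g g₀≈0 N k<N = trans (+-congˡ (powS-vanish g g₀≈0 N k<N)) (+-identityʳ _)

  partialGeom≈recip1- : ∀ g → g 0 ≈ 0# → ∀ {i k} → i ≤′ k → partialGeom g (suc k) i ≈ recip1- g i
  partialGeom≈recip1- g g₀≈0 ≤′-refl = refl
  partialGeom≈recip1- g g₀≈0 {i} (≤′-step {n = k} i≤′k) =
    trans (partialGeom-stable g g₀≈0 (suc k) (s≤s (ℕ.≤′⇒≤ i≤′k))) (partialGeom≈recip1- g g₀≈0 i≤′k)

  recip1--fixpoint : ∀ g → g 0 ≈ 0# → recip1- g ≈ˢ (oneS ⊕ (g ⊛ recip1- g))
  recip1--fixpoint g g₀≈0 k = begin
    partialGeom g (suc k) k              ≈⟨ partialGeom-stable g g₀≈0 (suc k) (ℕ.n<1+n k) ⟨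
    partialGeom g (suc (suc k)) k        ≈⟨ partialGeom-suc g (suc k) k ⟩
    oneS k + (g ⊛ partialGeom g (suc k)) k
      ≈⟨ +-congˡ (⊛-coeff-cong {g} k (λ _ → refl) (λ i≤k → partialGeom≈recip1- g g₀≈0 (ℕ.≤⇒≤′ i≤k))) ⟩
    oneS k + (g ⊛ recip1- g) k           ∎

  FixpointUpTo : Ser → ℕ → Ser → Set ℓ
  FixpointUpTo g d r = ∀ {k} → k ≤ d → r k ≈ oneS k + (g ⊛ r) k

  recip1--FixpointUpTo : ∀ g → g 0 ≈ 0# → ∀ d → FixpointUpTo g d (recip1- g)
  recip1--FixpointUpTo g g₀≈0 d {k} _ = recip1--fixpoint g g₀≈0 k

  -- Since g has no constant term, the coefficient k of 1 + g r only involves r below k.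
  FixpointUpTo-unique : ∀ g → g 0 ≈ 0# → ∀ d {r s} → FixpointUpTo g d r → FixpointUpTo g d s → ∀ {k} → k ≤ d → r k ≈ s k
  FixpointUpTo-unique g g₀≈0 d {r} {s} fix-r fix-s {k} k≤d = below k k≤d ℕ.≤-refl
    where
    g-free-coeff₀ : ∀ t → oneS 0 + (g ⊛ t) 0 ≈ 1# + 0#
    g-free-coeff₀ t = +-congˡ (trans (⊛-coeff₀ g t) (trans (*-congʳ g₀≈0) (zeroˡ _)))

    g-free-coeff-suc : ∀ t k → oneS (suc k) + (g ⊛ t) (suc k) ≈ (shift g ⊛ t) k
    g-free-coeff-suc t k = trans (+-identityˡ _) (trans (⊛-coeff-suc g t k) (trans (+-congʳ (trans (*-congʳ g₀≈0) (zeroˡ _))) (+-identityˡ _)))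

    at : ∀ k → k ≤ d → (∀ {i} → i < k → r i ≈ s i) → r k ≈ s k
    at zero k≤d _ = trans (fix-r k≤d) (trans (g-free-coeff₀ r) (sym (trans (fix-s k≤d) (g-free-coeff₀ s))))
    at (suc k) k≤d r≈s = trans (fix-r k≤d) (trans (g-free-coeff-suc r k)
      (trans (⊛-coeff-cong {shift g} k (λ _ → refl) (λ i≤k → r≈s (s≤s i≤k))) (sym (trans (fix-s k≤d) (g-free-coeff-suc s k)))))

    below : ∀ k → k ≤ d → ∀ {i} → i ≤ k → r i ≈ s i
    below zero k≤d z≤n = at zero k≤d λ ()
    below (suc k) k≤d i≤sk with ℕ.m≤n⇒m<n∨m≡n i≤sk
    ... | inj₁ i<sk = below k (ℕ.≤-trans (ℕ.n≤1+n k) k≤d) (ℕ.≤-pred i<sk)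
    ... | inj₂ ≡.refl = at (suc k) k≤d (λ j<sk → below k (ℕ.≤-trans (ℕ.n≤1+n k) k≤d) (ℕ.≤-pred j<sk))

module ContinuedFraction {c ℓ} (R : CommutativeRing c ℓ) (p q x : CommutativeRing.Carrier R) where
  open CommutativeRing R hiding (zero)
  open PQX R p q x
  open PowerSeries R
  open import Relation.Binary.Reasoning.Setoid setoid

  a : ℕ → Carrier
  a = bracket

  -- U h = Σ_k a_h a_{h+1} ⋯ a_{h+k-1} z^k, so that U h = 1 + a_h z · U (h+1) and G = z · a_1 · U 2.
  U : ℕ → Ser
  U h zero = 1#
  U h (suc k) = a h * U (suc h) k

  U-recurrence : ∀ h → (monoZ (a h) ⊛ U (suc h)) ≈ˢ (U h ⊖ oneS)
  U-recurrence h zero = trans (monoZ-⊛-coeff₀ (a h) (U (suc h))) (sym (-‿inverseʳ 1#))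
  U-recurrence h (suc k) = trans (monoZ-⊛-coeff-suc (a h) (U (suc h)) k) (sym (x-0≈x _))

  Uinv : ℕ → Ser
  Uinv h = recip1- (oneS ⊖ U h)

  U⊛Uinv : ∀ h → (U h ⊛ Uinv h) ≈ˢ oneS
  U⊛Uinv h k = x≈y+[x-z]⇒z≈y (Uinv h k) (oneS k) ((U h ⊛ Uinv h) k) (begin
    Uinv h k                                               ≈⟨ recip1--fixpoint (oneS ⊖ U h) (-‿inverseʳ 1#) k ⟩
    oneS k + ((oneS ⊖ U h) ⊛ Uinv h) k                     ≈⟨ +-congˡ (⊖-⊛ oneS (U h) (Uinv h) k) ⟩
    oneS k + ((oneS ⊛ Uinv h) k - (U h ⊛ Uinv h) k)        ≈⟨ +-congˡ (+-congʳ (oneS-⊛ (Uinv h) k)) ⟩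
    oneS k + (Uinv h k - (U h ⊛ Uinv h) k)                 ∎)

  Uinv⊛U : ∀ h → (Uinv h ⊛ U h) ≈ˢ oneS
  Uinv⊛U h k = trans (⊛-comm (Uinv h) (U h) k) (U⊛Uinv h k)

  private
    -- V h = U (h+1) / U h is 1 / (1 + a_h z - (1 - 1 / U (h+1))), the inner fraction at level h.
    V : ℕ → Ser
    V h = U (suc h) ⊛ Uinv h

    monoZ⊛V : ∀ h → (monoZ (a h) ⊛ V h) ≈ˢ (oneS ⊖ Uinv h)
    monoZ⊛V h k = begin
      (monoZ (a h) ⊛ (U (suc h) ⊛ Uinv h)) k     ≈⟨ ⊛-assoc (monoZ (a h)) (U (suc h)) (Uinv h) k ⟨
      ((monoZ (a h) ⊛ U (suc h)) ⊛ Uinv h) k     ≈⟨ ⊛-cong {g = Uinv h} (U-recurrence h) (λ _ → refl) k ⟩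
      ((U h ⊖ oneS) ⊛ Uinv h) k                  ≈⟨ ⊖-⊛ (U h) oneS (Uinv h) k ⟩
      (U h ⊛ Uinv h) k - (oneS ⊛ Uinv h) k       ≈⟨ +-cong (U⊛Uinv h k) (-‿cong (oneS-⊛ (Uinv h) k)) ⟩
      oneS k - Uinv h k                          ∎

    Uinv⊛V : ∀ h → (Uinv (suc h) ⊛ V h) ≈ˢ Uinv h
    Uinv⊛V h k = begin
      (Uinv (suc h) ⊛ (U (suc h) ⊛ Uinv h)) k    ≈⟨ ⊛-assoc (Uinv (suc h)) (U (suc h)) (Uinv h) k ⟨
      ((Uinv (suc h) ⊛ U (suc h)) ⊛ Uinv h) k    ≈⟨ ⊛-cong {g = Uinv h} (Uinv⊛U (suc h)) (λ _ → refl) k ⟩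
      (oneS ⊛ Uinv h) k                          ≈⟨ oneS-⊛ (Uinv h) k ⟩
      Uinv h k                                   ∎

  E-coeff₀ : ∀ d h → E d h 0 ≈ 0#
  E-coeff₀ zero h = refl
  E-coeff₀ (suc d) h = monoZ-⊛-coeff₀ (a h) (recip1- (E d (suc h) ⊖ monoZ (a h)))

  E≈1-Uinv : ∀ d h {k} → k ≤ d → E d h k ≈ (oneS ⊖ Uinv h) k
  E≈1-Uinv zero h z≤n = sym (trans (+-congˡ (-‿cong (+-identityˡ 1#))) (-‿inverseʳ 1#))
  E≈1-Uinv (suc d) h {zero} _ = trans (monoZ-⊛-coeff₀ (a h) r) (sym (trans (+-congˡ (-‿cong (+-identityˡ 1#))) (-‿inverseʳ 1#)))
    where r = recip1- (E d (suc h) ⊖ monoZ (a h))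
  E≈1-Uinv (suc d) h {suc k} (s≤s k≤d) = begin
    (monoZ (a h) ⊛ r) (suc k)   ≈⟨ monoZ-⊛-coeff-suc (a h) r k ⟩
    a h * r k                   ≈⟨ *-congˡ (FixpointUpTo-unique g g₀≈0 d (recip1--FixpointUpTo g g₀≈0 d) V-fixpoint k≤d) ⟩
    a h * V h k                 ≈⟨ monoZ-⊛-coeff-suc (a h) (V h) k ⟨
    (monoZ (a h) ⊛ V h) (suc k) ≈⟨ monoZ⊛V h (suc k) ⟩
    (oneS ⊖ Uinv h) (suc k)     ∎
    where
    g : Ser
    g = E d (suc h) ⊖ monoZ (a h)
    r : Ser
    r = recip1- g
    g₀≈0 : g 0 ≈ 0#
    g₀≈0 = trans (x-0≈x _) (E-coeff₀ d (suc h))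
    V-fixpoint : FixpointUpTo g d (V h)
    V-fixpoint {k} k≤d = sym (begin
      oneS k + (g ⊛ V h) k
        ≈⟨ +-congˡ (⊛-coeff-cong {g = V h} k (λ i≤k → +-congʳ (E≈1-Uinv d (suc h) (ℕ.≤-trans i≤k k≤d))) (λ _ → refl)) ⟩
      oneS k + (((oneS ⊖ Uinv (suc h)) ⊖ monoZ (a h)) ⊛ V h) k
        ≈⟨ +-congˡ (⊖-⊛ (oneS ⊖ Uinv (suc h)) (monoZ (a h)) (V h) k) ⟩
      oneS k + (((oneS ⊖ Uinv (suc h)) ⊛ V h) k - (monoZ (a h) ⊛ V h) k)
        ≈⟨ +-congˡ (+-cong (⊖-⊛ oneS (Uinv (suc h)) (V h) k) (-‿cong (monoZ⊛V h k))) ⟩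
      oneS k + (((oneS ⊛ V h) k - (Uinv (suc h) ⊛ V h) k) - (oneS k - Uinv h k))
        ≈⟨ +-congˡ (+-congʳ (+-cong (oneS-⊛ (V h) k) (-‿cong (Uinv⊛V h k)))) ⟩
      oneS k + ((V h k - Uinv h k) - (oneS k - Uinv h k))
        ≈⟨ +-congˡ ([x-z]-[y-z]≈x-y (V h k) (oneS k) (Uinv h k)) ⟩
      oneS k + (V h k - oneS k)
        ≈⟨ x+[y-x]≈y (oneS k) (V h k) ⟩
      V h k ∎)

  G≈U₁ : ∀ k → prod1To k a ≈ U 1 k
  G≈U₁ zero = refl
  G≈U₁ (suc k) = trans (*-congʳ (G≈U₁ k)) (sym (U-snoc 1 k))
    where
    U-snoc : ∀ h k → U h (suc k) ≈ U h k * a (h ℕ.+ k)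
    U-snoc h zero = trans (*-comm _ _) (*-congˡ (reflexive (≡.cong a (≡.sym (ℕ.+-identityʳ h)))))
    U-snoc h (suc k) = begin
      a h * U (suc h) (suc k)                    ≈⟨ *-congˡ (U-snoc (suc h) k) ⟩
      a h * (U (suc h) k * a (suc h ℕ.+ k))      ≈⟨ *-assoc _ _ _ ⟨
      (a h * U (suc h) k) * a (suc h ℕ.+ k)      ≈⟨ *-congˡ (reflexive (≡.cong a (≡.sym (ℕ.+-suc h k)))) ⟩
      U h (suc k) * a (h ℕ.+ suc k)              ∎

  CF≈G : ∀ n N → n ≤ N → CF N n ≈ G n
  CF≈G zero N _ = monoZ-⊛-coeff₀ (a 1) (recip1- (E N 2))
  CF≈G (suc m) N sm≤N = begin
    CF N (suc m)                  ≈⟨ monoZ-⊛-coeff-suc (a 1) (recip1- (E N 2)) m ⟩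
    a 1 * recip1- (E N 2) m
      ≈⟨ *-congˡ (FixpointUpTo-unique (E N 2) (E-coeff₀ N 2) N (recip1--FixpointUpTo (E N 2) (E-coeff₀ N 2) N) U₂-fixpoint m≤N) ⟩
    U 1 (suc m)                   ≈⟨ G≈U₁ (suc m) ⟨
    G (suc m)                     ∎
    where
    m≤N : m ≤ N
    m≤N = ℕ.≤-trans (ℕ.n≤1+n m) sm≤N
    U₂-fixpoint : FixpointUpTo (E N 2) N (U 2)
    U₂-fixpoint {k} k≤N = sym (begin
      oneS k + (E N 2 ⊛ U 2) k                      ≈⟨ +-congˡ (⊛-coeff-cong {g = U 2} k (λ i≤k → E≈1-Uinv N 2 (ℕ.≤-trans i≤k k≤N)) (λ _ → refl)) ⟩
      oneS k + ((oneS ⊖ Uinv 2) ⊛ U 2) k            ≈⟨ +-congˡ (⊖-⊛ oneS (Uinv 2) (U 2) k) ⟩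
      oneS k + ((oneS ⊛ U 2) k - (Uinv 2 ⊛ U 2) k)  ≈⟨ +-congˡ (+-cong (oneS-⊛ (U 2) k) (-‿cong (Uinv⊛U 2 k))) ⟩
      oneS k + (U 2 k - oneS k)                     ≈⟨ x+[y-x]≈y (oneS k) (U 2 k) ⟩
      U 2 k                                         ∎)

mainTheorem1 : ∀ {c ℓ} (R : CommutativeRing c ℓ) (p q x : CommutativeRing.Carrier R) →
    let open CommutativeRing R using (_≈_) in
    let open PQX R p q x in
    (n : ℕ) →
      (F n ≈ G n) × (Σ ℕ (λ N₀ → (N : ℕ) → N₀ ≤ N → CF N n ≈ G n))
mainTheorem1 R p q x n = WeightSum.F≈G R p q x n , n , ContinuedFraction.CF≈G R p q x n
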